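{- For every finite set of assumptions $\Gamma$, every (possibly open) orchestrator term $f$ and all session contracts $\rho,\sigma$: if the judgement $\Gamma\vdash f:\rho\asymp\sigma$ is derivable in the inference system described in the context, then $\Gamma\models f:\rho\asymp\sigma$, i.e. for every map $\theta$ from variables to closed orchestrators such that $\theta(x):\rho'\dashv_{ds}\sigma'$ for every assumption $(x:\rho'\asymp\sigma')\in\Gamma$, we have $\theta(f):\rho\dashv_{ds}\sigma$, where $\theta(f)$ is obtained from $f$ by replacing every free occurrence of each variable $x$ by $\theta(x)$.
   Context: Names and actions. Fix a countable set $\mathcal N$ of names; let $\overline{\mathcal N}=\{\overline a\mid a\in\mathcal N\}$, $\mathrm{Act}=\mathcal N\cup\overline{\mathcal N}$, and $\overline{\overline a}=a$. Session contracts. Raw session contracts are given by $\sigma::=\mathbf 1\mid a_1.\sigma_1+\cdots+a_n.\sigma_n\mid \overline a_1.\sigma_1\oplus\cdots\oplus\overline a_n.\sigma_n\mid x\mid \mathrm{rec}\,x.\sigma$ with $n\ge 1$, $a_i\in\mathcal N$, $x$ ranging over variables and $\mathrm{rec}$ binding. A session contract is a closed raw session contract in which the $a_i$ of each external choice ($+$) and the $\overline a_i$ of each internal choice ($\oplus$) are pairwise distinct, and in each $\mathrm{rec}\,x.\sigma$ the body $\sigma$ is not a variable. Recursion is equi-recursive ($\mathrm{rec}\,x.\sigma$ is identified with $\sigma\{\mathrm{rec}\,x.\sigma/x\}$) and choices are considered modulo commutativity; $\mathbf 1$ is success. Transitions (top level only), for $1\le k\le n$: $\bigoplus_{i=1}^n\overline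 a_i.\sigma_i\xrightarrow{\tau}\overline a_k.\sigma_k$; $\overline a.\sigma\xrightarrow{\overline a}\sigma$; $\sum_{i=1}^n a_i.\sigma_i\xrightarrow{a_k}\sigma_k$. Orchestration actions: $\mu::=\iota_L\mid\iota_R\mid o$ with $\iota_L::=\langle a,\varepsilon\rangle\mid\langle a,\overline a\rangle$, $\iota_R::=\langle\varepsilon,a\rangle\mid\langle\overline a,a\rangle$, $o::=\langle\overline a,\varepsilon\rangle\mid\langle\varepsilon,\overline a\rangle$ ($a\in\mathcal N$). Orchestrator terms: $f::=\mathbf 1\mid\iota_L.f_1\vee\cdots\vee\iota_L.f_n\mid\iota_R.f_1\vee\cdots\vee\iota_R.f_n\mid o.f\mid x\mid\mathrm{rec}\,x.f$ ($n\ge1$, body of $\mathrm{rec}$ not a variable), equi-recursive; orchestrators are the closed terms. Transitions: $\mu.f\xrightarrow{\mu}f$, and if $f\xrightarrow{\mu}f'$ then $f\vee g\xrightarrow{\mu}f'$ and $g\vee f\xrightarrow{\mu}f'$. A finite sequence $\vec\mu=\mu_1\cdots\mu_n$ is a trace of $f$ if $f\xrightarrow{\mu_1}f_1\cdots\xrightarrow{\mu_n}f_n$ for some $f_i$. Orchestrated systems $\rho\|_f\sigma$ (client $\rho$, orchestrator $f$, server $\sigma$): if $\rho\xrightarrow{\tau}\rho'$ then $\rho\|_f\sigma\to\rho'\|_f\sigma$; if $\sigma\xrightarrow{\tau}\sigma'$ then $\rho\|_f\sigma\to\rho\|_f\sigma'$; for $\alpha\in\mathrm{Act}$: if $\rho\xrightarrow{\alpha}\rho'$,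 $f\xrightarrow{\langle\overline\alpha,\alpha\rangle}f'$, $\sigma\xrightarrow{\overline\alpha}\sigma'$ then $\rho\|_f\sigma\xrightarrow{\langle\overline\alpha,\alpha\rangle}\rho'\|_{f'}\sigma'$; if $\rho\xrightarrow{\overline\alpha}\rho'$ and $f\xrightarrow{\langle\alpha,\varepsilon\rangle}f'$ then $\rho\|_f\sigma\xrightarrow{\langle\alpha,\varepsilon\rangle}\rho'\|_{f'}\sigma$; if $f\xrightarrow{\langle\varepsilon,\alpha\rangle}f'$ and $\sigma\xrightarrow{\overline\alpha}\sigma'$ then $\rho\|_f\sigma\xrightarrow{\langle\varepsilon,\alpha\rangle}\rho\|_{f'}\sigma'$. Write $\Rightarrow^{\mu}$ for $\to^*\xrightarrow{\mu}\to^*$, $\Rightarrow^{\vec\mu}$ for the composition along $\vec\mu$ (and $\to^*$ for empty $\vec\mu$). $\rho\|_f\sigma\not\to$ means no unlabelled step and no $\Rightarrow^{\mu}$ step is possible. Disrespectful compliance. $f$ is $\rho\cdot\sigma$-strict if for every finite trace $\vec\mu$ of $f$, $\rho\|_f\sigma\Rightarrow^{\vec\mu}$ (some run exists). $f:\rho\dashv_{ds}\sigma$ iff $f$ is $\rho\cdot\sigma$-strict and, for all finite $\vec\mu$ and all $\rho',f',\sigma'$, $\rho\|_f\sigma\Rightarrow^{\vec\mu}\rho'\|_{f'}\sigma'\not\to$ implies $\rho'=\mathbf 1$. Inference system. Judgements $\Gamma\vdash f:\rho\asymp\sigma$ with $\rho,\sigma$ session contracts, $f$ a possibly open orchestrator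 term, $\Gamma$ a finite set of assumptions $x:\rho_i\asymp\sigma_i$ such that a given pair $\rho_i\asymp\sigma_i$ is assigned at most one variable. In rules introducing $\mathrm{rec}\,x$, $x$ is a variable not declared in $\Gamma$. Rules: (Ax) $\Gamma\vdash\mathbf 1:\mathbf 1\asymp\sigma$. (Hyp) $\Gamma,x:\rho\asymp\sigma\vdash x:\rho\asymp\sigma$. (SumL) for $p\in I$: from $\Gamma,x:\sum_{i\in I}a_i.\rho_i\asymp\sigma\vdash f':\rho_p\asymp\sigma$ infer $\Gamma\vdash\mathrm{rec}\,x.\langle\overline a_p,\varepsilon\rangle.f':\sum_{i\in I}a_i.\rho_i\asymp\sigma$. (SumR) for $p\in I$: from $\Gamma,x:\rho\asymp\sum_{i\in I}a_i.\sigma_i\vdash f':\rho\asymp\sigma_p$ infer $\Gamma\vdash\mathrm{rec}\,x.\langle\varepsilon,\overline a_p\rangle.f':\rho\asymp\sum_{i\in I}a_i.\sigma_i$. With $\rho^\oplus=\bigoplus_{i\in I}\overline a_i.\rho_i$ and $\sigma^\oplus=\bigoplus_{j\in J}\overline b_j.\sigma_j$: (OOA) from $\Gamma,x:\rho^\oplus\asymp\sigma^\oplus\vdash f_j:\rho^\oplus\asymp\sigma_j$ for all $j\in J$ infer $\Gamma\vdash\mathrm{rec}\,x.\bigvee_{j\in J}\langle\varepsilon,b_j\rangle.f_j:\rho^\oplus\asymp\sigma^\oplus$. (OOB) from $\Gamma,x:\rho^\oplus\asymp\sigma^\oplus\vdash f_i:\rho_i\asymp\sigma^\oplus$ for all $i\in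 I$ infer $\Gamma\vdash\mathrm{rec}\,x.\bigvee_{i\in I}\langle a_i,\varepsilon\rangle.f_i:\rho^\oplus\asymp\sigma^\oplus$. (OSum) for $\rho=\bigoplus_{i\in I}\overline a_i.\rho_i$, $\sigma=\sum_{j\in J}a_j.\sigma_j$, $\Gamma'=\Gamma,x:\rho\asymp\sigma$, $I=H\cup K$, $K\subseteq J$: from $\Gamma'\vdash f_i:\rho_i\asymp\sigma$ for all $i\in H$ and $\Gamma'\vdash f_i:\rho_i\asymp\sigma_i$ for all $i\in K$ infer $\Gamma\vdash\mathrm{rec}\,x.(\bigvee_{h\in H}\langle a_h,\varepsilon\rangle.f_h)\vee(\bigvee_{k\in K}\langle a_k,\overline a_k\rangle.f_k):\rho\asymp\sigma$. (SumO) for $\rho=\sum_{i\in I}a_i.\rho_i$, $\sigma=\bigoplus_{j\in J}\overline a_j.\sigma_j$, $\Gamma'=\Gamma,x:\rho\asymp\sigma$, $J=H\cup K$, $K\subseteq I$: from $\Gamma'\vdash f_j:\rho\asymp\sigma_j$ for all $j\in H$ and $\Gamma'\vdash f_j:\rho_j\asymp\sigma_j$ for all $j\in K$ infer $\Gamma\vdash\mathrm{rec}\,x.(\bigvee_{h\in H}\langle\varepsilon,a_h\rangle.f_h)\vee(\bigvee_{k\in K}\langle\overline a_k,a_k\rangle.f_k):\rho\asymp\sigma$. -}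

module Defs where

open import Data.Nat using (ℕ; zero; suc; _<_; _<ᵇ_)
open import Data.Bool using (if_then_else_)
open import Data.Product using (_×_; _,_; ∃-syntax)
open import Data.List using (List; []; _∷_; _++_; map)
open import Data.List.Relation.Unary.Unique.Propositional using (Unique)
open import Data.Empty using (⊥)
open import Data.Unit using (⊤)
open import Relation.Nullary using (¬_)
open import Relation.Binary.Construct.Closure.ReflexiveTransitive using (Star)

Name : Set
Name = ℕ

data Act : Set where
  nm : Name → Act
  co : Name → Act

bar : Act → Act
bar (nm a) = co a
bar (co a) = nm a

-- Raw session contracts (de Bruijn; rec binds index 0)

data SC : Set
data SBr : Set

data SC where
  𝟏   : SC
  ext : SBr → SC
  int : SBr → SC          -- ā₁.σ₁ ⊕ ⋯ ⊕ āₙ.σₙ  (names aᵢ stored)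
  var : ℕ → SC
  rec : SC → SC

infixr 5 _∙_∷_
data SBr where
  [_∙_]  : Name → SC → SBr
  _∙_∷_ : Name → SC → SBr → SBr

ssh  : ℕ → SC → SC
sshB : ℕ → SBr → SBr
ssh c 𝟏       = 𝟏
ssh c (ext b) = ext (sshB c b)
ssh c (int b) = int (sshB c b)
ssh c (var k) = if k <ᵇ c then var k else var (suc k)
ssh c (rec t) = rec (ssh (suc c) t)
sshB c [ a ∙ t ]    = [ a ∙ ssh c t ]
sshB c (a ∙ t ∷ b) = a ∙ ssh c t ∷ sshB c b

slift : (ℕ → SC) → ℕ → SC
slift θ zero    = var zero
slift θ (suc k) = ssh 0 (θ k)

ssub  : (ℕ → SC) → SC → SC
ssubB : (ℕ → SC) → SBr → SBr
ssub θ 𝟏       = 𝟏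
ssub θ (ext b) = ext (ssubB θ b)
ssub θ (int b) = int (ssubB θ b)
ssub θ (var k) = θ k
ssub θ (rec t) = rec (ssub (slift θ) t)
ssubB θ [ a ∙ t ]    = [ a ∙ ssub θ t ]
ssubB θ (a ∙ t ∷ b) = a ∙ ssub θ t ∷ ssubB θ b

-- σ{rec x.σ / x}, for the body σ of  rec x.σ
sunfold : SC → SC
sunfold t = ssub θ t
  where
  θ : ℕ → SC
  θ zero    = rec t
  θ (suc k) = var k

data _≈_  : SC → SC → Set
data _≈B_ : SBr → SBr → Set

data _≈_ where
  ≈refl   : ∀ {t} → t ≈ t
  ≈sym    : ∀ {t u} → t ≈ u → u ≈ t
  ≈trans  : ∀ {t u v} → t ≈ u → u ≈ v → t ≈ v
  ≈unfold : ∀ {t} → rec t ≈ sunfold t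
  ≈ext    : ∀ {b b'} → b ≈B b' → ext b ≈ ext b'
  ≈int    : ∀ {b b'} → b ≈B b' → int b ≈ int b'
  ≈rec    : ∀ {t u} → t ≈ u → rec t ≈ rec u

data _≈B_ where
  ≈Brefl  : ∀ {b} → b ≈B b
  ≈Bsym   : ∀ {b c} → b ≈B c → c ≈B b
  ≈Btrans : ∀ {b c d} → b ≈B c → c ≈B d → b ≈B d
  ≈Bone   : ∀ {a t u} → t ≈ u → [ a ∙ t ] ≈B [ a ∙ u ]
  ≈Bcons  : ∀ {a t u b c} → t ≈ u → b ≈B c → (a ∙ t ∷ b) ≈B (a ∙ u ∷ c)
  ≈Bswap2 : ∀ {a t a' t'} → (a ∙ t ∷ [ a' ∙ t' ]) ≈B (a' ∙ t' ∷ [ a ∙ t ])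
  ≈Bswap  : ∀ {a t a' t' b} → (a ∙ t ∷ a' ∙ t' ∷ b) ≈B (a' ∙ t' ∷ a ∙ t ∷ b)

names : SBr → List Name
names [ a ∙ t ]    = a ∷ []
names (a ∙ t ∷ b) = a ∷ names b

NotVar : SC → Set
NotVar (var _) = ⊥
NotVar _       = ⊤

data WFC  (n : ℕ) : SC → Set
data WFCB (n : ℕ) : SBr → Set

data WFC n where
  wf𝟏   : WFC n 𝟏
  wfext : ∀ {b} → Unique (names b) → WFCB n b → WFC n (ext b)
  wfint : ∀ {b} → Unique (names b) → WFCB n b → WFC n (int b)
  wfvar : ∀ {k} → k < n → WFC n (var k)
  wfrec : ∀ {t} → NotVar t → WFC (suc n) t → WFC n (rec t)

data WFCB n where
  wfone  : ∀ {a t} → WFC n t → WFCB n [ a ∙ t ]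
  wfcons : ∀ {a t b} → WFC n t → WFCB n b → WFCB n (a ∙ t ∷ b)

SessionContract : SC → Set
SessionContract = WFC 0

data _∈B_ : Name × SC → SBr → Set where
  here1 : ∀ {a t} → (a , t) ∈B [ a ∙ t ]
  here  : ∀ {a t b} → (a , t) ∈B (a ∙ t ∷ b)
  there : ∀ {p a t b} → p ∈B b → p ∈B (a ∙ t ∷ b)

data Lab : Set where
  τ   : Lab
  act : Act → Lab

data SStep : SC → Lab → SC → Set where
  intτ  : ∀ {a t b} → (a , t) ∈B b → SStep (int b) τ (int [ a ∙ t ])
  intO  : ∀ {a t} → SStep (int [ a ∙ t ]) (act (co a)) t
  extI  : ∀ {a t b} → (a , t) ∈B b → SStep (ext b) (act (nm a)) t
  recU  : ∀ {t l t'} → SStep (sunfold t) l t' → SStep (rec t) l t'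

-- Orchestration actions:  L α = ⟨α,ε⟩,  R α = ⟨ε,α⟩,  S α = ⟨ᾱ,α⟩

data OAct : Set where
  L : Act → OAct
  R : Act → OAct
  S : Act → OAct

data IL : Set where
  inL  : Name → IL
  synL : Name → IL
data IR : Set where
  inR  : Name → IR
  synR : Name → IR
data OO : Set where
  outL : Name → OO
  outR : Name → OO

⌊_⌋L : IL → OAct
⌊ inL a ⌋L  = L (nm a)
⌊ synL a ⌋L = S (co a)

⌊_⌋R : IR → OAct
⌊ inR a ⌋R  = R (nm a)
⌊ synR a ⌋R = S (nm a)

⌊_⌋O : OO → OAct
⌊ outL a ⌋O = L (co a)
⌊ outR a ⌋O = R (co a)

data Orch : Set
data OBr (P : Set) : Set

data Orch where
  o𝟏   : Orch
  orL  : OBr IL → Orch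
  orR  : OBr IR → Orch
  pre  : OO → Orch → Orch
  ovar : ℕ → Orch
  orec : Orch → Orch

infixr 5 _∙_∷ᵒ_
data OBr P where
  ⟦_∙_⟧   : P → Orch → OBr P
  _∙_∷ᵒ_ : P → Orch → OBr P → OBr P

osh  : ℕ → Orch → Orch
oshB : ∀ {P} → ℕ → OBr P → OBr P
osh c o𝟏       = o𝟏
osh c (orL b)  = orL (oshB c b)
osh c (orR b)  = orR (oshB c b)
osh c (pre o f) = pre o (osh c f)
osh c (ovar k) = if k <ᵇ c then ovar k else ovar (suc k)
osh c (orec f) = orec (osh (suc c) f)
oshB c ⟦ p ∙ f ⟧     = ⟦ p ∙ osh c f ⟧
oshB c (p ∙ f ∷ᵒ b) = p ∙ osh c f ∷ᵒ oshB c b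

olift : (ℕ → Orch) → ℕ → Orch
olift θ zero    = ovar zero
olift θ (suc k) = osh 0 (θ k)

osub  : (ℕ → Orch) → Orch → Orch
osubB : ∀ {P} → (ℕ → Orch) → OBr P → OBr P
osub θ o𝟏        = o𝟏
osub θ (orL b)   = orL (osubB θ b)
osub θ (orR b)   = orR (osubB θ b)
osub θ (pre o f) = pre o (osub θ f)
osub θ (ovar k)  = θ k
osub θ (orec f)  = orec (osub (olift θ) f)
osubB θ ⟦ p ∙ f ⟧     = ⟦ p ∙ osub θ f ⟧
osubB θ (p ∙ f ∷ᵒ b) = p ∙ osub θ f ∷ᵒ osubB θ b

ounfold : Orch → Orch
ounfold f = osub θ f
  where
  θ : ℕ → Orch
  θ zero    = orec f
  θ (suc k) = ovar k

data _≈ᵒ_ : Orch → Orch → Set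
data _≈ᵒB_ {P : Set} : OBr P → OBr P → Set

data _≈ᵒ_ where
  ≈ᵒrefl   : ∀ {f} → f ≈ᵒ f
  ≈ᵒsym    : ∀ {f g} → f ≈ᵒ g → g ≈ᵒ f
  ≈ᵒtrans  : ∀ {f g h} → f ≈ᵒ g → g ≈ᵒ h → f ≈ᵒ h
  ≈ᵒunfold : ∀ {f} → orec f ≈ᵒ ounfold f
  ≈ᵒL      : ∀ {b c} → b ≈ᵒB c → orL b ≈ᵒ orL c
  ≈ᵒR      : ∀ {b c} → b ≈ᵒB c → orR b ≈ᵒ orR c
  ≈ᵒpre    : ∀ {o f g} → f ≈ᵒ g → pre o f ≈ᵒ pre o g
  ≈ᵒrec    : ∀ {f g} → f ≈ᵒ g → orec f ≈ᵒ orec g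

data _≈ᵒB_ {P} where
  ≈ᵒBrefl  : ∀ {b} → b ≈ᵒB b
  ≈ᵒBsym   : ∀ {b c} → b ≈ᵒB c → c ≈ᵒB b
  ≈ᵒBtrans : ∀ {b c d} → b ≈ᵒB c → c ≈ᵒB d → b ≈ᵒB d
  ≈ᵒBone   : ∀ {p f g} → f ≈ᵒ g → ⟦ p ∙ f ⟧ ≈ᵒB ⟦ p ∙ g ⟧
  ≈ᵒBcons  : ∀ {p f g b c} → f ≈ᵒ g → b ≈ᵒB c → (p ∙ f ∷ᵒ b) ≈ᵒB (p ∙ g ∷ᵒ c)
  ≈ᵒBswap2 : ∀ {p f q g} → (p ∙ f ∷ᵒ ⟦ q ∙ g ⟧) ≈ᵒB (q ∙ g ∷ᵒ ⟦ p ∙ f ⟧)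
  ≈ᵒBswap  : ∀ {p f q g b} → (p ∙ f ∷ᵒ q ∙ g ∷ᵒ b) ≈ᵒB (q ∙ g ∷ᵒ p ∙ f ∷ᵒ b)

ONotVar : Orch → Set
ONotVar (ovar _) = ⊥
ONotVar _        = ⊤

data OWF  (n : ℕ) : Orch → Set
data OWFB {P : Set} (n : ℕ) : OBr P → Set

data OWF n where
  owf𝟏   : OWF n o𝟏
  owfL   : ∀ {b} → OWFB n b → OWF n (orL b)
  owfR   : ∀ {b} → OWFB n b → OWF n (orR b)
  owfpre : ∀ {o f} → OWF n f → OWF n (pre o f)
  owfvar : ∀ {k} → k < n → OWF n (ovar k)
  owfrec : ∀ {f} → ONotVar f → OWF (suc n) f → OWF n (orec f)

data OWFB n where
  owfone  : ∀ {p f} → OWF n f → OWFB n ⟦ p ∙ f ⟧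
  owfcons : ∀ {p f b} → OWF n f → OWFB n b → OWFB n (p ∙ f ∷ᵒ b)

data OTerm : Orch → Set
data OTermB {P : Set} : OBr P → Set

data OTerm where
  ot𝟏   : OTerm o𝟏
  otL   : ∀ {b} → OTermB b → OTerm (orL b)
  otR   : ∀ {b} → OTermB b → OTerm (orR b)
  otpre : ∀ {o f} → OTerm f → OTerm (pre o f)
  otvar : ∀ {k} → OTerm (ovar k)
  otrec : ∀ {f} → ONotVar f → OTerm f → OTerm (orec f)

data OTermB where
  otone  : ∀ {p f} → OTerm f → OTermB ⟦ p ∙ f ⟧
  otcons : ∀ {p f b} → OTerm f → OTermB b → OTermB (p ∙ f ∷ᵒ b)

Orchestrator : Orch → Set
Orchestrator = OWF 0

data _∈OB_ {P : Set} : P × Orch → OBr P → Set where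
  here1 : ∀ {p f} → (p , f) ∈OB ⟦ p ∙ f ⟧
  here  : ∀ {p f b} → (p , f) ∈OB (p ∙ f ∷ᵒ b)
  there : ∀ {x p f b} → x ∈OB b → x ∈OB (p ∙ f ∷ᵒ b)

data OStep : Orch → OAct → Orch → Set where
  preS : ∀ {o f} → OStep (pre o f) ⌊ o ⌋O f
  orLS : ∀ {p f b} → (p , f) ∈OB b → OStep (orL b) ⌊ p ⌋L f
  orRS : ∀ {p f b} → (p , f) ∈OB b → OStep (orR b) ⌊ p ⌋R f
  recS : ∀ {f μ g} → OStep (ounfold f) μ g → OStep (orec f) μ g

data OTrace : Orch → List OAct → Set where
  tnil  : ∀ {f} → OTrace f []
  tcons : ∀ {f μ f' μs} → OStep f μ f' → OTrace f' μs → OTrace f (μ ∷ μs)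

record Sys : Set where
  constructor _∥[_]_
  field
    client : SC
    orch   : Orch
    server : SC

data _⟶_ : Sys → Sys → Set where
  τC : ∀ {ρ ρ' f σ} → SStep ρ τ ρ' → (ρ ∥[ f ] σ) ⟶ (ρ' ∥[ f ] σ)
  τS : ∀ {ρ f σ σ'} → SStep σ τ σ' → (ρ ∥[ f ] σ) ⟶ (ρ ∥[ f ] σ')

data _⟶[_]_ : Sys → OAct → Sys → Set where
  syncS  : ∀ {ρ ρ' f f' σ σ' α} → SStep ρ (act α) ρ' → OStep f (S α) f' →
           SStep σ (act (bar α)) σ' → (ρ ∥[ f ] σ) ⟶[ S α ] (ρ' ∥[ f' ] σ')
  leftS  : ∀ {ρ ρ' f f' σ α} → SStep ρ (act (bar α)) ρ' → OStep f (L α) f' →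
           (ρ ∥[ f ] σ) ⟶[ L α ] (ρ' ∥[ f' ] σ)
  rightS : ∀ {ρ f f' σ σ' α} → OStep f (R α) f' → SStep σ (act (bar α)) σ' →
           (ρ ∥[ f ] σ) ⟶[ R α ] (ρ ∥[ f' ] σ')

_⟶*_ : Sys → Sys → Set
_⟶*_ = Star _⟶_

data _⇒[_]_ : Sys → List OAct → Sys → Set where
  wdone : ∀ {s s'} → s ⟶* s' → s ⇒[ [] ] s'
  wstep : ∀ {s s₁ s₂ s' μ μs} → s ⟶* s₁ → s₁ ⟶[ μ ] s₂ → s₂ ⇒[ μs ] s' →
          s ⇒[ μ ∷ μs ] s'

Stuck : Sys → Set
Stuck s = (∀ s' → ¬ (s ⟶ s')) × (∀ μ s' → ¬ (s ⇒[ μ ∷ [] ] s'))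

Strict : Orch → SC → SC → Set
Strict f ρ σ = ∀ μs → OTrace f μs → ∃[ s' ] ((ρ ∥[ f ] σ) ⇒[ μs ] s')

_∶_⊣ds_ : Orch → SC → SC → Set
f ∶ ρ ⊣ds σ = Strict f ρ σ ×
  (∀ μs ρ' f' σ' → (ρ ∥[ f ] σ) ⇒[ μs ] (ρ' ∥[ f' ] σ') →
     Stuck (ρ' ∥[ f' ] σ') → ρ' ≈ 𝟏)

-- Contexts: de Bruijn index i refers to the i-th assumption

Ctx : Set
Ctx = List (SC × SC)

data _∋_∶_≍_ : Ctx → ℕ → SC → SC → Set where
  here  : ∀ {Γ ρ σ} → ((ρ , σ) ∷ Γ) ∋ zero ∶ ρ ≍ σ
  there : ∀ {Γ p i ρ σ} → Γ ∋ i ∶ ρ ≍ σ → (p ∷ Γ) ∋ suc i ∶ ρ ≍ σ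

PairFresh : Ctx → SC → SC → Set
PairFresh Γ ρ σ = ∀ i ρ' σ' → Γ ∋ i ∶ ρ' ≍ σ' → ¬ ((ρ ≈ ρ') × (σ ≈ σ'))

data ValidCtx : Ctx → Set where
  vnil  : ValidCtx []
  vcons : ∀ {Γ ρ σ} → ValidCtx Γ → SessionContract ρ → SessionContract σ →
          PairFresh Γ ρ σ → ValidCtx ((ρ , σ) ∷ Γ)

data BrRel {P : Set} (R : Name → SC → Orch → Set) (mk : Name → P) :
           SBr → OBr P → Set where
  brone  : ∀ {a t f} → R a t f → BrRel R mk [ a ∙ t ] ⟦ mk a ∙ f ⟧
  brcons : ∀ {a t f b ob} → R a t f → BrRel R mk b ob →
           BrRel R mk (a ∙ t ∷ b) (mk a ∙ f ∷ᵒ ob)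

toOBr : ∀ {P : Set} → P × Orch → List (P × Orch) → OBr P
toOBr (p , f) []       = ⟦ p ∙ f ⟧
toOBr (p , f) (q ∷ qs) = p ∙ f ∷ᵒ toOBr q qs

-- For rules OSum/SumO: each branch index of the internal choice lies in
-- H only, in K only, or in both H and K (I = H ∪ K), K ⊆ names of the
-- external choice.  (RH a t f) is the premise for an index in H,
-- (RK a t t' f) the premise for an index in K whose partner continuation is t'.
data HK1 {P : Set} (RH : SC → Orch → Set) (RK : SC → SC → Orch → Set)
         (mkH mkK : Name → P) (ext-b : SBr) :
         Name → SC → List (P × Orch) → Set where
  onlyH : ∀ {a t f} → RH t f → HK1 RH RK mkH mkK ext-b a t ((mkH a , f) ∷ [])
  onlyK : ∀ {a t t' f} → (a , t') ∈B ext-b → RK t t' f →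
          HK1 RH RK mkH mkK ext-b a t ((mkK a , f) ∷ [])
  both  : ∀ {a t t' f} → RH t f → (a , t') ∈B ext-b → RK t t' f →
          HK1 RH RK mkH mkK ext-b a t ((mkH a , f) ∷ (mkK a , f) ∷ [])

data HK {P : Set} (RH : SC → Orch → Set) (RK : SC → SC → Orch → Set)
        (mkH mkK : Name → P) (ext-b : SBr) : SBr → List (P × Orch) → Set where
  hkone  : ∀ {a t ps} → HK1 RH RK mkH mkK ext-b a t ps →
           HK RH RK mkH mkK ext-b [ a ∙ t ] ps
  hkcons : ∀ {a t b ps qs} → HK1 RH RK mkH mkK ext-b a t ps →
           HK RH RK mkH mkK ext-b b qs →
           HK RH RK mkH mkK ext-b (a ∙ t ∷ b) (ps ++ qs)

data _⊢_∶_≍_ : Ctx → Orch → SC → SC → Set where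
  Ax   : ∀ {Γ σ} → SessionContract σ → Γ ⊢ o𝟏 ∶ 𝟏 ≍ σ
  Hyp  : ∀ {Γ i ρ σ} → SessionContract ρ → SessionContract σ →
         Γ ∋ i ∶ ρ ≍ σ → Γ ⊢ ovar i ∶ ρ ≍ σ
  -- judgements are on terms modulo the identifications
  Conv : ∀ {Γ f f' ρ ρ' σ σ'} → Γ ⊢ f ∶ ρ ≍ σ → f ≈ᵒ f' → ρ ≈ ρ' → σ ≈ σ' →
         OTerm f' → SessionContract ρ' → SessionContract σ' → Γ ⊢ f' ∶ ρ' ≍ σ'
  SumL : ∀ {Γ b σ a ρp f} → SessionContract (ext b) → SessionContract σ →
         PairFresh Γ (ext b) σ → (a , ρp) ∈B b →
         ((ext b , σ) ∷ Γ) ⊢ f ∶ ρp ≍ σ →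
         Γ ⊢ orec (pre (outL a) f) ∶ ext b ≍ σ
  SumR : ∀ {Γ ρ b a σp f} → SessionContract ρ → SessionContract (ext b) →
         PairFresh Γ ρ (ext b) → (a , σp) ∈B b →
         ((ρ , ext b) ∷ Γ) ⊢ f ∶ ρ ≍ σp →
         Γ ⊢ orec (pre (outR a) f) ∶ ρ ≍ ext b
  OOA  : ∀ {Γ bρ bσ ob} → SessionContract (int bρ) → SessionContract (int bσ) →
         PairFresh Γ (int bρ) (int bσ) →
         BrRel (λ _ σj fj → ((int bρ , int bσ) ∷ Γ) ⊢ fj ∶ int bρ ≍ σj) inR bσ ob →
         Γ ⊢ orec (orR ob) ∶ int bρ ≍ int bσ
  OOB  : ∀ {Γ bρ bσ ob} → SessionContract (int bρ) → SessionContract (int bσ) →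
         PairFresh Γ (int bρ) (int bσ) →
         BrRel (λ _ ρi fi → ((int bρ , int bσ) ∷ Γ) ⊢ fi ∶ ρi ≍ int bσ) inL bρ ob →
         Γ ⊢ orec (orL ob) ∶ int bρ ≍ int bσ
  OSum : ∀ {Γ bρ bσ p ps} → SessionContract (int bρ) → SessionContract (ext bσ) →
         PairFresh Γ (int bρ) (ext bσ) →
         HK (λ ρi fi → ((int bρ , ext bσ) ∷ Γ) ⊢ fi ∶ ρi ≍ ext bσ)
            (λ ρi σi fi → ((int bρ , ext bσ) ∷ Γ) ⊢ fi ∶ ρi ≍ σi)
            inL synL bσ bρ (p ∷ ps) →
         Γ ⊢ orec (orL (toOBr p ps)) ∶ int bρ ≍ ext bσ
  SumO : ∀ {Γ bρ bσ p ps} → SessionContract (ext bρ) → SessionContract (int bσ) →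
         PairFresh Γ (ext bρ) (int bσ) →
         HK (λ σj fj → ((ext bρ , int bσ) ∷ Γ) ⊢ fj ∶ ext bρ ≍ σj)
            (λ σj ρj fj → ((ext bρ , int bσ) ∷ Γ) ⊢ fj ∶ ρj ≍ σj)
            inR synR bρ bσ (p ∷ ps) →
         Γ ⊢ orec (orR (toOBr p ps)) ∶ ext bρ ≍ int bσ

_⊨_∶_≍_ : Ctx → Orch → SC → SC → Set
Γ ⊨ f ∶ ρ ≍ σ = ∀ (θ : ℕ → Orch) → (∀ i → Orchestrator (θ i)) →
  (∀ i ρ' σ' → Γ ∋ i ∶ ρ' ≍ σ' → θ i ∶ ρ' ⊣ds σ') →
  osub θ f ∶ ρ ⊣ds σ

module Submission where

-- The recursive rules make a direct induction impossible (the hypothesis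
-- x ∶ ρ ≍ σ is used while proving ρ ≍ σ), so we use step indexing:
-- DS n f ρ σ asserts strictness and compliance for traces and runs with at
-- most n visible actions.  The fundamental lemma proves DS n (θ f) ρ σ for
-- every n by induction on n and then on the derivation; a rule for rec x.f
-- only consumes the assumption on x one visible action later, i.e. at n - 1.

open import Defs
open import Data.Nat using (ℕ; zero; suc; _<ᵇ_; _≤_; s≤s)
open import Data.Nat.Properties using (≤-refl; m≤n⇒m≤1+n)
open import Data.Bool using (true; false; if_then_else_)
open import Data.Product using (_×_; _,_; ∃-syntax; proj₁; proj₂)
open import Data.List using ([]; _∷_; length)
open import Data.List.Membership.Propositional using (_∈_)
open import Data.List.Membership.Propositional.Properties using (∈-++⁻)
open import Data.List.Relation.Unary.Any using () renaming (here to hereₗ; there to thereₗ)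
open import Data.List.Relation.Unary.All using (All)
open import Data.List.Relation.Unary.AllPairs using (AllPairs)
open import Data.List.Relation.Unary.Unique.Propositional using (Unique)
open import Data.Empty using (⊥-elim)
open import Data.Sum using (_⊎_; inj₁; inj₂)
open import Relation.Nullary using (¬_)
open import Relation.Binary.PropositionalEquality
open import Relation.Binary.Construct.Closure.ReflexiveTransitive using (Star; ε; _◅_; _◅◅_; gmap)

shiftFrom : ℕ → ℕ → ℕ
shiftFrom c k = if k <ᵇ c then k else suc k

liftRen : (ℕ → ℕ) → ℕ → ℕ
liftRen r zero    = zero
liftRen r (suc k) = suc (r k)

liftRen-shiftFrom : ∀ c k → liftRen (shiftFrom c) k ≡ shiftFrom (suc c) k
liftRen-shiftFrom c zero = refl
liftRen-shiftFrom c (suc k) with k <ᵇ c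
... | true  = refl
... | false = refl

sren  : (ℕ → ℕ) → SC → SC
srenB : (ℕ → ℕ) → SBr → SBr
sren r 𝟏       = 𝟏
sren r (ext b) = ext (srenB r b)
sren r (int b) = int (srenB r b)
sren r (var k) = var (r k)
sren r (rec t) = rec (sren (liftRen r) t)
srenB r [ a ∙ t ]    = [ a ∙ sren r t ]
srenB r (a ∙ t ∷ b) = a ∙ sren r t ∷ srenB r b

sren-ext  : ∀ {r r'} → (∀ k → r k ≡ r' k) → ∀ t → sren r t ≡ sren r' t
srenB-ext : ∀ {r r'} → (∀ k → r k ≡ r' k) → ∀ b → srenB r b ≡ srenB r' b
sren-ext e 𝟏       = refl
sren-ext e (ext b) = cong ext (srenB-ext e b)
sren-ext e (int b) = cong int (srenB-ext e b)
sren-ext e (var k) = cong var (e k)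
sren-ext {r} {r'} e (rec t) = cong rec (sren-ext e' t)
  where e' : ∀ k → liftRen r k ≡ liftRen r' k
        e' zero    = refl
        e' (suc k) = cong suc (e k)
srenB-ext e [ a ∙ t ]    = cong [ a ∙_] (sren-ext e t)
srenB-ext e (a ∙ t ∷ b) = cong₂ (a ∙_∷_) (sren-ext e t) (srenB-ext e b)

ssh-ren  : ∀ c t → ssh c t ≡ sren (shiftFrom c) t
sshB-ren : ∀ c b → sshB c b ≡ srenB (shiftFrom c) b
ssh-ren c 𝟏       = refl
ssh-ren c (ext b) = cong ext (sshB-ren c b)
ssh-ren c (int b) = cong int (sshB-ren c b)
ssh-ren c (var k) with k <ᵇ c
... | true  = refl
... | false = refl
ssh-ren c (rec t) = cong rec (trans (ssh-ren (suc c) t) (sym (sren-ext (liftRen-shiftFrom c) t)))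
sshB-ren c [ a ∙ t ]    = cong [ a ∙_] (ssh-ren c t)
sshB-ren c (a ∙ t ∷ b) = cong₂ (a ∙_∷_) (ssh-ren c t) (sshB-ren c b)

ssh0 : ∀ t → ssh 0 t ≡ sren suc t
ssh0 t = trans (ssh-ren 0 t) (sren-ext (λ k → refl) t)

ssub-ext  : ∀ {θ θ'} → (∀ k → θ k ≡ θ' k) → ∀ t → ssub θ t ≡ ssub θ' t
ssubB-ext : ∀ {θ θ'} → (∀ k → θ k ≡ θ' k) → ∀ b → ssubB θ b ≡ ssubB θ' b
ssub-ext e 𝟏       = refl
ssub-ext e (ext b) = cong ext (ssubB-ext e b)
ssub-ext e (int b) = cong int (ssubB-ext e b)
ssub-ext e (var k) = e k
ssub-ext {θ} {θ'} e (rec t) = cong rec (ssub-ext e' t)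
  where e' : ∀ k → slift θ k ≡ slift θ' k
        e' zero    = refl
        e' (suc k) = cong (ssh 0) (e k)
ssubB-ext e [ a ∙ t ]    = cong [ a ∙_] (ssub-ext e t)
ssubB-ext e (a ∙ t ∷ b) = cong₂ (a ∙_∷_) (ssub-ext e t) (ssubB-ext e b)

sren-sren  : ∀ r r' t → sren r (sren r' t) ≡ sren (λ k → r (r' k)) t
srenB-sren : ∀ r r' b → srenB r (srenB r' b) ≡ srenB (λ k → r (r' k)) b
sren-sren r r' 𝟏       = refl
sren-sren r r' (ext b) = cong ext (srenB-sren r r' b)
sren-sren r r' (int b) = cong int (srenB-sren r r' b)
sren-sren r r' (var k) = refl
sren-sren r r' (rec t) =
  cong rec (trans (sren-sren (liftRen r) (liftRen r') t) (sren-ext e t))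
  where e : ∀ k → liftRen r (liftRen r' k) ≡ liftRen (λ k → r (r' k)) k
        e zero    = refl
        e (suc k) = refl
srenB-sren r r' [ a ∙ t ]    = cong [ a ∙_] (sren-sren r r' t)
srenB-sren r r' (a ∙ t ∷ b) = cong₂ (a ∙_∷_) (sren-sren r r' t) (srenB-sren r r' b)

ssub-sren  : ∀ θ r t → ssub θ (sren r t) ≡ ssub (λ k → θ (r k)) t
ssubB-srenB : ∀ θ r b → ssubB θ (srenB r b) ≡ ssubB (λ k → θ (r k)) b
ssub-sren θ r 𝟏       = refl
ssub-sren θ r (ext b) = cong ext (ssubB-srenB θ r b)
ssub-sren θ r (int b) = cong int (ssubB-srenB θ r b)
ssub-sren θ r (var k) = refl
ssub-sren θ r (rec t) =
  cong rec (trans (ssub-sren (slift θ) (liftRen r) t) (ssub-ext e t))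
  where e : ∀ k → slift θ (liftRen r k) ≡ slift (λ k → θ (r k)) k
        e zero    = refl
        e (suc k) = refl
ssubB-srenB θ r [ a ∙ t ]    = cong [ a ∙_] (ssub-sren θ r t)
ssubB-srenB θ r (a ∙ t ∷ b) = cong₂ (a ∙_∷_) (ssub-sren θ r t) (ssubB-srenB θ r b)

sren-ssub  : ∀ r θ t → sren r (ssub θ t) ≡ ssub (λ k → sren r (θ k)) t
srenB-ssubB : ∀ r θ b → srenB r (ssubB θ b) ≡ ssubB (λ k → sren r (θ k)) b
sren-ssub r θ 𝟏       = refl
sren-ssub r θ (ext b) = cong ext (srenB-ssubB r θ b)
sren-ssub r θ (int b) = cong int (srenB-ssubB r θ b)
sren-ssub r θ (var k) = refl
sren-ssub r θ (rec t) =
  cong rec (trans (sren-ssub (liftRen r) (slift θ) t) (ssub-ext e t))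
  where
  open ≡-Reasoning
  e : ∀ k → sren (liftRen r) (slift θ k) ≡ slift (λ k → sren r (θ k)) k
  e zero    = refl
  e (suc k) = begin
    sren (liftRen r) (ssh 0 (θ k))     ≡⟨ cong (sren (liftRen r)) (ssh0 (θ k)) ⟩
    sren (liftRen r) (sren suc (θ k))  ≡⟨ sren-sren (liftRen r) suc (θ k) ⟩
    sren (λ j → suc (r j)) (θ k)       ≡⟨ sym (sren-sren suc r (θ k)) ⟩
    sren suc (sren r (θ k))            ≡⟨ sym (ssh0 (sren r (θ k))) ⟩
    ssh 0 (sren r (θ k))               ∎
srenB-ssubB r θ [ a ∙ t ]    = cong [ a ∙_] (sren-ssub r θ t)
srenB-ssubB r θ (a ∙ t ∷ b) = cong₂ (a ∙_∷_) (sren-ssub r θ t) (srenB-ssubB r θ b)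

ssub-ssub  : ∀ θ ψ t → ssub θ (ssub ψ t) ≡ ssub (λ k → ssub θ (ψ k)) t
ssubB-ssubB : ∀ θ ψ b → ssubB θ (ssubB ψ b) ≡ ssubB (λ k → ssub θ (ψ k)) b
ssub-ssub θ ψ 𝟏       = refl
ssub-ssub θ ψ (ext b) = cong ext (ssubB-ssubB θ ψ b)
ssub-ssub θ ψ (int b) = cong int (ssubB-ssubB θ ψ b)
ssub-ssub θ ψ (var k) = refl
ssub-ssub θ ψ (rec t) =
  cong rec (trans (ssub-ssub (slift θ) (slift ψ) t) (ssub-ext e t))
  where
  open ≡-Reasoning
  e : ∀ k → ssub (slift θ) (slift ψ k) ≡ slift (λ k → ssub θ (ψ k)) k
  e zero    = refl
  e (suc k) = begin
    ssub (slift θ) (ssh 0 (ψ k))        ≡⟨ cong (ssub (slift θ)) (ssh0 (ψ k)) ⟩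
    ssub (slift θ) (sren suc (ψ k))     ≡⟨ ssub-sren (slift θ) suc (ψ k) ⟩
    ssub (λ j → ssh 0 (θ j)) (ψ k)      ≡⟨ ssub-ext (λ j → ssh0 (θ j)) (ψ k) ⟩
    ssub (λ j → sren suc (θ j)) (ψ k)   ≡⟨ sym (sren-ssub suc θ (ψ k)) ⟩
    sren suc (ssub θ (ψ k))             ≡⟨ sym (ssh0 (ssub θ (ψ k))) ⟩
    ssh 0 (ssub θ (ψ k))                ∎
ssubB-ssubB θ ψ [ a ∙ t ]    = cong [ a ∙_] (ssub-ssub θ ψ t)
ssubB-ssubB θ ψ (a ∙ t ∷ b) = cong₂ (a ∙_∷_) (ssub-ssub θ ψ t) (ssubB-ssubB θ ψ b)

ssub-id  : ∀ t → ssub var t ≡ t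
ssubB-id : ∀ b → ssubB var b ≡ b
ssub-id 𝟏       = refl
ssub-id (ext b) = cong ext (ssubB-id b)
ssub-id (int b) = cong int (ssubB-id b)
ssub-id (var k) = refl
ssub-id (rec t) = cong rec (trans (ssub-ext e t) (ssub-id t))
  where e : ∀ k → slift var k ≡ var k
        e zero    = refl
        e (suc k) = refl
ssubB-id [ a ∙ t ]    = cong [ a ∙_] (ssub-id t)
ssubB-id (a ∙ t ∷ b) = cong₂ (a ∙_∷_) (ssub-id t) (ssubB-id b)

sren-as-ssub  : ∀ r t → sren r t ≡ ssub (λ k → var (r k)) t
srenB-as-ssubB : ∀ r b → srenB r b ≡ ssubB (λ k → var (r k)) b
sren-as-ssub r 𝟏       = refl
sren-as-ssub r (ext b) = cong ext (srenB-as-ssubB r b)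
sren-as-ssub r (int b) = cong int (srenB-as-ssubB r b)
sren-as-ssub r (var k) = refl
sren-as-ssub r (rec t) = cong rec (trans (sren-as-ssub (liftRen r) t) (ssub-ext e t))
  where e : ∀ k → var (liftRen r k) ≡ slift (λ k → var (r k)) k
        e zero    = refl
        e (suc k) = refl
srenB-as-ssubB r [ a ∙ t ]    = cong [ a ∙_] (sren-as-ssub r t)
srenB-as-ssubB r (a ∙ t ∷ b) = cong₂ (a ∙_∷_) (sren-as-ssub r t) (srenB-as-ssubB r b)

_∷ₛ_ : SC → (ℕ → SC) → ℕ → SC
(x ∷ₛ θ) zero    = x
(x ∷ₛ θ) (suc k) = θ k

sunfold-def : ∀ t → sunfold t ≡ ssub (rec t ∷ₛ var) t
sunfold-def t = ssub-ext (λ { zero → refl ; (suc k) → refl }) t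

unfold-ssub : ∀ θ t → sunfold (ssub (slift θ) t) ≡ ssub (ssub θ (rec t) ∷ₛ θ) t
unfold-ssub θ t = begin
    sunfold (ssub (slift θ) t)                               ≡⟨ sunfold-def (ssub (slift θ) t) ⟩
    ssub (rec t' ∷ₛ var) (ssub (slift θ) t)                  ≡⟨ ssub-ssub _ (slift θ) t ⟩
    ssub (λ k → ssub (rec t' ∷ₛ var) (slift θ k)) t          ≡⟨ ssub-ext e t ⟩
    ssub (ssub θ (rec t) ∷ₛ θ) t                             ∎
  where
  open ≡-Reasoning
  t' = ssub (slift θ) t
  e : ∀ k → ssub (rec t' ∷ₛ var) (slift θ k) ≡ (ssub θ (rec t) ∷ₛ θ) k
  e zero    = refl
  e (suc k) = trans (cong (ssub _) (ssh0 (θ k))) (trans (ssub-sren _ suc (θ k)) (ssub-id (θ k)))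

ssub-unfold : ∀ θ t → ssub θ (sunfold t) ≡ ssub (ssub θ (rec t) ∷ₛ θ) t
ssub-unfold θ t = trans (cong (ssub θ) (sunfold-def t))
  (trans (ssub-ssub θ (rec t ∷ₛ var) t) (ssub-ext (λ { zero → refl ; (suc k) → refl }) t))

≡⇒≈ : ∀ {t u} → t ≡ u → t ≈ u
≡⇒≈ refl = ≈refl

-- the unfolding axiom is preserved thanks to unfold-ssub and ssub-unfold
ssub-≈  : ∀ θ {t u} → t ≈ u → ssub θ t ≈ ssub θ u
ssubB-≈ : ∀ θ {b c} → b ≈B c → ssubB θ b ≈B ssubB θ c
ssub-≈ θ ≈refl           = ≈refl
ssub-≈ θ (≈sym d)        = ≈sym (ssub-≈ θ d)
ssub-≈ θ (≈trans d d')   = ≈trans (ssub-≈ θ d) (ssub-≈ θ d')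
ssub-≈ θ (≈unfold {t})   = ≈trans ≈unfold (≡⇒≈ (trans (unfold-ssub θ t) (sym (ssub-unfold θ t))))
ssub-≈ θ (≈ext d)        = ≈ext (ssubB-≈ θ d)
ssub-≈ θ (≈int d)        = ≈int (ssubB-≈ θ d)
ssub-≈ θ (≈rec d)        = ≈rec (ssub-≈ (slift θ) d)
ssubB-≈ θ ≈Brefl         = ≈Brefl
ssubB-≈ θ (≈Bsym d)      = ≈Bsym (ssubB-≈ θ d)
ssubB-≈ θ (≈Btrans d d') = ≈Btrans (ssubB-≈ θ d) (ssubB-≈ θ d')
ssubB-≈ θ (≈Bone d)      = ≈Bone (ssub-≈ θ d)
ssubB-≈ θ (≈Bcons d d')  = ≈Bcons (ssub-≈ θ d) (ssubB-≈ θ d')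
ssubB-≈ θ ≈Bswap2        = ≈Bswap2
ssubB-≈ θ ≈Bswap         = ≈Bswap

ssub-pointwise  : ∀ {θ θ'} → (∀ k → θ k ≈ θ' k) → ∀ t → ssub θ t ≈ ssub θ' t
ssubB-pointwise : ∀ {θ θ'} → (∀ k → θ k ≈ θ' k) → ∀ b → ssubB θ b ≈B ssubB θ' b
ssub-pointwise e 𝟏       = ≈refl
ssub-pointwise e (ext b) = ≈ext (ssubB-pointwise e b)
ssub-pointwise e (int b) = ≈int (ssubB-pointwise e b)
ssub-pointwise e (var k) = e k
ssub-pointwise {θ} {θ'} e (rec t) = ≈rec (ssub-pointwise e' t)
  where
  shift-≈ : ∀ {x y} → x ≈ y → ssh 0 x ≈ ssh 0 y
  shift-≈ {x} {y} d = ≈trans (≡⇒≈ (trans (ssh0 x) (sren-as-ssub suc x)))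
    (≈trans (ssub-≈ _ d) (≡⇒≈ (sym (trans (ssh0 y) (sren-as-ssub suc y)))))
  e' : ∀ k → slift θ k ≈ slift θ' k
  e' zero    = ≈refl
  e' (suc k) = shift-≈ (e k)
ssubB-pointwise e [ a ∙ t ]    = ≈Bone (ssub-pointwise e t)
ssubB-pointwise e (a ∙ t ∷ b) = ≈Bcons (ssub-pointwise e t) (ssubB-pointwise e b)

-- A term rec x.…rec y.x (a recursion whose body is, after peeling off
-- recursions, one of its own bound variables) has no transitions at all.
-- The head of a term records whether it is guarded (a prefix or 𝟏 on top),
-- such a loop, or a free variable reached through recursions.

data Head : Set where
  guarded : Head
  headVar : ℕ → Head
  loop    : Head

underRec : Head → Head
underRec (headVar zero)    = loop
underRec (headVar (suc k)) = headVar k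
underRec h                 = h

renameHead : (ℕ → ℕ) → Head → Head
renameHead r (headVar k) = headVar (r k)
renameHead r h           = h

underRec-liftRen : ∀ r h → underRec (renameHead (liftRen r) h) ≡ renameHead r (underRec h)
underRec-liftRen r guarded           = refl
underRec-liftRen r (headVar zero)    = refl
underRec-liftRen r (headVar (suc x)) = refl
underRec-liftRen r loop              = refl

underRec-suc : ∀ h → underRec (renameHead suc h) ≡ h
underRec-suc guarded     = refl
underRec-suc (headVar x) = refl
underRec-suc loop        = refl

headZero? : ∀ h → (h ≡ headVar zero) ⊎ ¬ (h ≡ headVar zero)
headZero? guarded           = inj₂ λ ()
headZero? (headVar zero)    = inj₁ refl
headZero? (headVar (suc k)) = inj₂ λ ()
headZero? loop              = inj₂ λ ()

sHead : SC → Head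
sHead (var k) = headVar k
sHead (rec t) = underRec (sHead t)
sHead _       = guarded

sBindHead : (ℕ → SC) → Head → Head
sBindHead θ (headVar k) = sHead (θ k)
sBindHead θ h           = h

sHead-sren : ∀ r t → sHead (sren r t) ≡ renameHead r (sHead t)
sHead-sren r 𝟏       = refl
sHead-sren r (ext _) = refl
sHead-sren r (int _) = refl
sHead-sren r (var _) = refl
sHead-sren r (rec t) = trans (cong underRec (sHead-sren (liftRen r) t)) (underRec-liftRen r (sHead t))

sHead-ssub : ∀ θ t → sHead (ssub θ t) ≡ sBindHead θ (sHead t)
sHead-ssub θ 𝟏       = refl
sHead-ssub θ (ext _) = refl
sHead-ssub θ (int _) = refl
sHead-ssub θ (var _) = refl
sHead-ssub θ (rec t) = trans (cong underRec (sHead-ssub (slift θ) t)) (lifted (sHead t))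
  where
  lifted : ∀ h → underRec (sBindHead (slift θ) h) ≡ sBindHead θ (underRec h)
  lifted guarded           = refl
  lifted (headVar zero)    = refl
  lifted (headVar (suc k)) =
    trans (cong underRec (trans (cong sHead (ssh0 (θ k))) (sHead-sren suc (θ k))))
          (underRec-suc (sHead (θ k)))
  lifted loop              = refl

sHead-unfold : ∀ t → sHead (sunfold t) ≡ underRec (sHead t)
sHead-unfold t = trans (cong sHead (sunfold-def t))
                       (trans (sHead-ssub (rec t ∷ₛ var) t) (unfolded (sHead t) refl))
  where
  unfolded : ∀ h → sHead t ≡ h → sBindHead (rec t ∷ₛ var) h ≡ underRec h
  unfolded guarded           _ = refl
  unfolded (headVar zero)    e = cong underRec e
  unfolded (headVar (suc k)) _ = refl
  unfolded loop              _ = refl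

sHead-≈ : ∀ {t u} → t ≈ u → sHead t ≡ sHead u
sHead-≈ ≈refl           = refl
sHead-≈ (≈sym d)        = sym (sHead-≈ d)
sHead-≈ (≈trans d d')   = trans (sHead-≈ d) (sHead-≈ d')
sHead-≈ (≈unfold {t})   = sym (sHead-unfold t)
sHead-≈ (≈ext _)        = refl
sHead-≈ (≈int _)        = refl
sHead-≈ (≈rec d)        = cong underRec (sHead-≈ d)

sHead-loop : ∀ θ {t} → sHead t ≡ headVar zero → sHead (ssub θ (rec t)) ≡ loop
sHead-loop θ {t} e = trans (sHead-ssub θ (rec t)) (cong (λ h → sBindHead θ (underRec h)) e)

sLoop-inert : ∀ {x l y} → sHead x ≡ loop → ¬ SStep x l y
sLoop-inert {rec t} e (recU d) = sLoop-inert (trans (sHead-unfold t) e) d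

module UpTo {S L : Set} (Step : S → L → S → Set) (_~_ : S → S → Set)
            (~refl : ∀ {x} → x ~ x) (~trans : ∀ {x y z} → x ~ y → y ~ z → x ~ z) where

  Sim1 : S → S → Set
  Sim1 x y = ∀ {l x'} → Step x l x' → ∃[ y' ] (Step y l y' × x' ~ y')

  Sim : S → S → Set
  Sim x y = Sim1 x y × Sim1 y x

  Sim-refl : ∀ {x} → Sim x x
  Sim-refl = (λ d → _ , d , ~refl) , (λ d → _ , d , ~refl)

  Sim-≡ : ∀ {x y} → x ≡ y → Sim x y
  Sim-≡ refl = Sim-refl

  Sim-sym : ∀ {x y} → Sim x y → Sim y x
  Sim-sym (p , q) = q , p

  Sim-trans : ∀ {x y z} → Sim x y → Sim y z → Sim x z
  Sim-trans (p , q) (p' , q') = compose p p' , compose q' q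
    where
    compose : ∀ {x y z} → Sim1 x y → Sim1 y z → Sim1 x z
    compose p q d with p d
    ... | _ , d' , e with q d'
    ... | z' , d'' , e' = z' , d'' , ~trans e e'

  Sim-inert : ∀ {x y} → (∀ {l x'} → ¬ Step x l x') → (∀ {l y'} → ¬ Step y l y') → Sim x y
  Sim-inert nx ny = (λ d → ⊥-elim (nx d)) , (λ d → ⊥-elim (ny d))

module C = UpTo SStep _≈_ ≈refl ≈trans

-- number of branches minus one
branchCount : SBr → ℕ
branchCount [ _ ∙ _ ]    = zero
branchCount (_ ∙ _ ∷ b) = suc (branchCount b)

branchCount-≈ : ∀ {b c} → b ≈B c → branchCount b ≡ branchCount c
branchCount-≈ ≈Brefl         = refl
branchCount-≈ (≈Bsym d)      = sym (branchCount-≈ d)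
branchCount-≈ (≈Btrans d d') = trans (branchCount-≈ d) (branchCount-≈ d')
branchCount-≈ (≈Bone _)      = refl
branchCount-≈ (≈Bcons _ d)   = cong suc (branchCount-≈ d)
branchCount-≈ ≈Bswap2        = refl
branchCount-≈ ≈Bswap         = refl

BranchSim : SBr → SBr → Set
BranchSim b c = ∀ {a x} → (a , x) ∈B b → ∃[ y ] ((a , y) ∈B c × x ≈ y)

≈B⇒BranchSim : ∀ {b c} → b ≈B c → BranchSim b c × BranchSim c b
≈B⇒BranchSim ≈Brefl = (λ m → _ , m , ≈refl) , (λ m → _ , m , ≈refl)
≈B⇒BranchSim (≈Bsym d) = let (p , q) = ≈B⇒BranchSim d in q , p
≈B⇒BranchSim (≈Btrans d d') =
  let (p , q) = ≈B⇒BranchSim d ; (p' , q') = ≈B⇒BranchSim d' in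
  (λ m → let (_ , m' , e) = p m ; (z , m'' , e') = p' m' in z , m'' , ≈trans e e') ,
  (λ m → let (_ , m' , e) = q' m ; (z , m'' , e') = q m' in z , m'' , ≈trans e e')
≈B⇒BranchSim (≈Bone e) = (λ { here1 → _ , here1 , e }) , (λ { here1 → _ , here1 , ≈sym e })
≈B⇒BranchSim (≈Bcons e d) = let (p , q) = ≈B⇒BranchSim d in
  (λ { here → _ , here , e ; (there m) → let (y , m' , e') = p m in y , there m' , e' }) ,
  (λ { here → _ , here , ≈sym e ; (there m) → let (y , m' , e') = q m in y , there m' , e' })
≈B⇒BranchSim ≈Bswap2 =
  (λ { here → _ , there here1 , ≈refl ; (there here1) → _ , here , ≈refl }) ,
  (λ { here → _ , there here1 , ≈refl ; (there here1) → _ , here , ≈refl })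
≈B⇒BranchSim ≈Bswap =
  (λ { here → _ , there here , ≈refl ; (there here) → _ , here , ≈refl
     ; (there (there m)) → _ , there (there m) , ≈refl }) ,
  (λ { here → _ , there here , ≈refl ; (there here) → _ , here , ≈refl
     ; (there (there m)) → _ , there (there m) , ≈refl })

Sim-ext : ∀ {b c} → b ≈B c → C.Sim (ext b) (ext c)
Sim-ext d = let (p , q) = ≈B⇒BranchSim d in match p , match q
  where
  match : ∀ {b c} → BranchSim b c → C.Sim1 (ext b) (ext c)
  match p (extI m) = let (y , m' , e) = p m in y , extI m' , e

-- an internal choice with one branch can only output; the branch count
-- guarantees that the matching choice has a single branch as well
Sim-int : ∀ {b c} → b ≈B c → C.Sim (int b) (int c)
Sim-int d = let (p , q) = ≈B⇒BranchSim d in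
  match (branchCount-≈ d) p , match (sym (branchCount-≈ d)) q
  where
  match : ∀ {b c} → branchCount b ≡ branchCount c → BranchSim b c → C.Sim1 (int b) (int c)
  match _ p (intτ m) = let (y , m' , e) = p m in int [ _ ∙ y ] , intτ m' , ≈int (≈Bone e)
  match {c = [ _ ∙ _ ]} _ p intO with p here1
  ... | y , here1 , e = y , intO , e
  match {c = _ ∙ _ ∷ _} () _ intO

ssub-rec-step : ∀ θ t {l x'} → SStep (ssub θ (rec t)) l x' → SStep (ssub (ssub θ (rec t) ∷ₛ θ) t) l x'
ssub-rec-step θ t (recU d) = subst (λ z → SStep z _ _) (unfold-ssub θ t) d

ssub-rec-step⁻ : ∀ θ t {l x'} → SStep (ssub (ssub θ (rec t) ∷ₛ θ) t) l x' → SStep (ssub θ (rec t)) l x'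
ssub-rec-step⁻ θ t d = recU (subst (λ z → SStep z _ _) (sym (unfold-ssub θ t)) d)

Sim-ssub-rec : ∀ θ θ' t t' → C.Sim (ssub (ssub θ (rec t) ∷ₛ θ) t) (ssub (ssub θ' (rec t') ∷ₛ θ') t') →
               C.Sim (ssub θ (rec t)) (ssub θ' (rec t'))
Sim-ssub-rec θ θ' t t' (p , q) =
  (λ d → let (y , d' , e) = p (ssub-rec-step θ t d) in y , ssub-rec-step⁻ θ' t' d' , e) ,
  (λ d → let (y , d' , e) = q (ssub-rec-step θ' t' d) in y , ssub-rec-step⁻ θ t d' , e)

Sim-ssub-pointwise : ∀ t θ θ' → (∀ k → θ k ≈ θ' k) →
  (∀ k → sHead t ≡ headVar k → C.Sim (θ k) (θ' k)) → C.Sim (ssub θ t) (ssub θ' t)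
Sim-ssub-pointwise 𝟏       θ θ' pw hd = (λ ()) , (λ ())
Sim-ssub-pointwise (ext b) θ θ' pw hd = Sim-ext (ssubB-pointwise pw b)
Sim-ssub-pointwise (int b) θ θ' pw hd = Sim-int (ssubB-pointwise pw b)
Sim-ssub-pointwise (var k) θ θ' pw hd = hd k refl
Sim-ssub-pointwise (rec t) θ θ' pw hd with headZero? (sHead t)
... | inj₁ e  = C.Sim-inert (sLoop-inert (sHead-loop θ {t} e)) (sLoop-inert (sHead-loop θ' {t} e))
... | inj₂ ne = Sim-ssub-rec θ θ' t t (Sim-ssub-pointwise t _ _ pw' hd')
  where
  pw' : ∀ k → (ssub θ (rec t) ∷ₛ θ) k ≈ (ssub θ' (rec t) ∷ₛ θ') k
  pw' zero    = ssub-pointwise pw (rec t)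
  pw' (suc k) = pw k
  hd' : ∀ k → sHead t ≡ headVar k → C.Sim ((ssub θ (rec t) ∷ₛ θ) k) ((ssub θ' (rec t) ∷ₛ θ') k)
  hd' zero    e = ⊥-elim (ne e)
  hd' (suc k) e = hd k (cong underRec e)

≈-Sim-ssub : ∀ {t u} → t ≈ u → ∀ θ → C.Sim (ssub θ t) (ssub θ u)
≈-Sim-ssub ≈refl θ         = C.Sim-refl
≈-Sim-ssub (≈sym d) θ      = C.Sim-sym (≈-Sim-ssub d θ)
≈-Sim-ssub (≈trans d d') θ = C.Sim-trans (≈-Sim-ssub d θ) (≈-Sim-ssub d' θ)
≈-Sim-ssub (≈unfold {t}) θ =
  C.Sim-trans ((λ d → _ , ssub-rec-step θ t d , ≈refl) , (λ d → _ , ssub-rec-step⁻ θ t d , ≈refl))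
            (C.Sim-≡ (sym (ssub-unfold θ t)))
≈-Sim-ssub (≈ext d) θ      = Sim-ext (ssubB-≈ θ d)
≈-Sim-ssub (≈int d) θ      = Sim-int (ssubB-≈ θ d)
≈-Sim-ssub (≈rec {t} {u} d) θ with headZero? (sHead u)
... | inj₁ e  = C.Sim-inert (sLoop-inert (sHead-loop θ {t} (trans (sHead-≈ d) e)))
                          (sLoop-inert (sHead-loop θ {u} e))
... | inj₂ ne = Sim-ssub-rec θ θ t u
  (C.Sim-trans (≈-Sim-ssub d (ssub θ (rec t) ∷ₛ θ)) (Sim-ssub-pointwise u _ _ pw hd))
  where
  pw : ∀ k → (ssub θ (rec t) ∷ₛ θ) k ≈ (ssub θ (rec u) ∷ₛ θ) k
  pw zero    = ssub-≈ θ (≈rec d)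
  pw (suc k) = ≈refl
  hd : ∀ k → sHead u ≡ headVar k → C.Sim ((ssub θ (rec t) ∷ₛ θ) k) ((ssub θ (rec u) ∷ₛ θ) k)
  hd zero    e = ⊥-elim (ne e)
  hd (suc k) e = C.Sim-refl

≈⇒Sim : ∀ {t u} → t ≈ u → C.Sim t u
≈⇒Sim {t} {u} d = subst₂ C.Sim (ssub-id t) (ssub-id u) (≈-Sim-ssub d var)

oren  : (ℕ → ℕ) → Orch → Orch
orenB : ∀ {P} → (ℕ → ℕ) → OBr P → OBr P
oren r o𝟏       = o𝟏
oren r (orL b)  = orL (orenB r b)
oren r (orR b)  = orR (orenB r b)
oren r (pre o f) = pre o (oren r f)
oren r (ovar k) = ovar (r k)
oren r (orec f) = orec (oren (liftRen r) f)
orenB r ⟦ p ∙ f ⟧     = ⟦ p ∙ oren r f ⟧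
orenB r (p ∙ f ∷ᵒ b) = p ∙ oren r f ∷ᵒ orenB r b

oren-ext  : ∀ {r r'} → (∀ k → r k ≡ r' k) → ∀ f → oren r f ≡ oren r' f
orenB-ext : ∀ {P r r'} → (∀ k → r k ≡ r' k) → ∀ (b : OBr P) → orenB r b ≡ orenB r' b
oren-ext e o𝟏       = refl
oren-ext e (orL b)  = cong orL (orenB-ext e b)
oren-ext e (orR b)  = cong orR (orenB-ext e b)
oren-ext e (pre o f) = cong (pre o) (oren-ext e f)
oren-ext e (ovar k) = cong ovar (e k)
oren-ext {r} {r'} e (orec f) = cong orec (oren-ext e' f)
  where e' : ∀ k → liftRen r k ≡ liftRen r' k
        e' zero    = refl
        e' (suc k) = cong suc (e k)
orenB-ext e ⟦ p ∙ f ⟧     = cong ⟦ p ∙_⟧ (oren-ext e f)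
orenB-ext e (p ∙ f ∷ᵒ b) = cong₂ (p ∙_∷ᵒ_) (oren-ext e f) (orenB-ext e b)

osh-ren  : ∀ c f → osh c f ≡ oren (shiftFrom c) f
oshB-ren : ∀ {P} c (b : OBr P) → oshB c b ≡ orenB (shiftFrom c) b
osh-ren c o𝟏       = refl
osh-ren c (orL b)  = cong orL (oshB-ren c b)
osh-ren c (orR b)  = cong orR (oshB-ren c b)
osh-ren c (pre o f) = cong (pre o) (osh-ren c f)
osh-ren c (ovar k) with k <ᵇ c
... | true  = refl
... | false = refl
osh-ren c (orec f) = cong orec (trans (osh-ren (suc c) f) (sym (oren-ext (liftRen-shiftFrom c) f)))
oshB-ren c ⟦ p ∙ f ⟧     = cong ⟦ p ∙_⟧ (osh-ren c f)
oshB-ren c (p ∙ f ∷ᵒ b) = cong₂ (p ∙_∷ᵒ_) (osh-ren c f) (oshB-ren c b)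

osh0 : ∀ f → osh 0 f ≡ oren suc f
osh0 f = trans (osh-ren 0 f) (oren-ext (λ k → refl) f)

osub-ext  : ∀ {θ θ'} → (∀ k → θ k ≡ θ' k) → ∀ f → osub θ f ≡ osub θ' f
osubB-ext : ∀ {P θ θ'} → (∀ k → θ k ≡ θ' k) → ∀ (b : OBr P) → osubB θ b ≡ osubB θ' b
osub-ext e o𝟏       = refl
osub-ext e (orL b)  = cong orL (osubB-ext e b)
osub-ext e (orR b)  = cong orR (osubB-ext e b)
osub-ext e (pre o f) = cong (pre o) (osub-ext e f)
osub-ext e (ovar k) = e k
osub-ext {θ} {θ'} e (orec f) = cong orec (osub-ext e' f)
  where e' : ∀ k → olift θ k ≡ olift θ' k
        e' zero    = refl
        e' (suc k) = cong (osh 0) (e k)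
osubB-ext e ⟦ p ∙ f ⟧     = cong ⟦ p ∙_⟧ (osub-ext e f)
osubB-ext e (p ∙ f ∷ᵒ b) = cong₂ (p ∙_∷ᵒ_) (osub-ext e f) (osubB-ext e b)

oren-oren  : ∀ r r' f → oren r (oren r' f) ≡ oren (λ k → r (r' k)) f
orenB-orenB : ∀ {P} r r' (b : OBr P) → orenB r (orenB r' b) ≡ orenB (λ k → r (r' k)) b
oren-oren r r' o𝟏       = refl
oren-oren r r' (orL b)  = cong orL (orenB-orenB r r' b)
oren-oren r r' (orR b)  = cong orR (orenB-orenB r r' b)
oren-oren r r' (pre o f) = cong (pre o) (oren-oren r r' f)
oren-oren r r' (ovar k) = refl
oren-oren r r' (orec f) =
  cong orec (trans (oren-oren (liftRen r) (liftRen r') f) (oren-ext e f))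
  where e : ∀ k → liftRen r (liftRen r' k) ≡ liftRen (λ k → r (r' k)) k
        e zero    = refl
        e (suc k) = refl
orenB-orenB r r' ⟦ p ∙ f ⟧     = cong ⟦ p ∙_⟧ (oren-oren r r' f)
orenB-orenB r r' (p ∙ f ∷ᵒ b) = cong₂ (p ∙_∷ᵒ_) (oren-oren r r' f) (orenB-orenB r r' b)

osub-oren  : ∀ θ r f → osub θ (oren r f) ≡ osub (λ k → θ (r k)) f
osubB-orenB : ∀ {P} θ r (b : OBr P) → osubB θ (orenB r b) ≡ osubB (λ k → θ (r k)) b
osub-oren θ r o𝟏       = refl
osub-oren θ r (orL b)  = cong orL (osubB-orenB θ r b)
osub-oren θ r (orR b)  = cong orR (osubB-orenB θ r b)
osub-oren θ r (pre o f) = cong (pre o) (osub-oren θ r f)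
osub-oren θ r (ovar k) = refl
osub-oren θ r (orec f) =
  cong orec (trans (osub-oren (olift θ) (liftRen r) f) (osub-ext e f))
  where e : ∀ k → olift θ (liftRen r k) ≡ olift (λ k → θ (r k)) k
        e zero    = refl
        e (suc k) = refl
osubB-orenB θ r ⟦ p ∙ f ⟧     = cong ⟦ p ∙_⟧ (osub-oren θ r f)
osubB-orenB θ r (p ∙ f ∷ᵒ b) = cong₂ (p ∙_∷ᵒ_) (osub-oren θ r f) (osubB-orenB θ r b)

oren-osub  : ∀ r θ f → oren r (osub θ f) ≡ osub (λ k → oren r (θ k)) f
orenB-osubB : ∀ {P} r θ (b : OBr P) → orenB r (osubB θ b) ≡ osubB (λ k → oren r (θ k)) b
oren-osub r θ o𝟏       = refl
oren-osub r θ (orL b)  = cong orL (orenB-osubB r θ b)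
oren-osub r θ (orR b)  = cong orR (orenB-osubB r θ b)
oren-osub r θ (pre o f) = cong (pre o) (oren-osub r θ f)
oren-osub r θ (ovar k) = refl
oren-osub r θ (orec f) =
  cong orec (trans (oren-osub (liftRen r) (olift θ) f) (osub-ext e f))
  where
  open ≡-Reasoning
  e : ∀ k → oren (liftRen r) (olift θ k) ≡ olift (λ k → oren r (θ k)) k
  e zero    = refl
  e (suc k) = begin
    oren (liftRen r) (osh 0 (θ k))     ≡⟨ cong (oren (liftRen r)) (osh0 (θ k)) ⟩
    oren (liftRen r) (oren suc (θ k))  ≡⟨ oren-oren (liftRen r) suc (θ k) ⟩
    oren (λ j → suc (r j)) (θ k)       ≡⟨ sym (oren-oren suc r (θ k)) ⟩
    oren suc (oren r (θ k))            ≡⟨ sym (osh0 (oren r (θ k))) ⟩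
    osh 0 (oren r (θ k))               ∎
orenB-osubB r θ ⟦ p ∙ f ⟧     = cong ⟦ p ∙_⟧ (oren-osub r θ f)
orenB-osubB r θ (p ∙ f ∷ᵒ b) = cong₂ (p ∙_∷ᵒ_) (oren-osub r θ f) (orenB-osubB r θ b)

osub-osub  : ∀ θ ψ f → osub θ (osub ψ f) ≡ osub (λ k → osub θ (ψ k)) f
osubB-osubB : ∀ {P} θ ψ (b : OBr P) → osubB θ (osubB ψ b) ≡ osubB (λ k → osub θ (ψ k)) b
osub-osub θ ψ o𝟏       = refl
osub-osub θ ψ (orL b)  = cong orL (osubB-osubB θ ψ b)
osub-osub θ ψ (orR b)  = cong orR (osubB-osubB θ ψ b)
osub-osub θ ψ (pre o f) = cong (pre o) (osub-osub θ ψ f)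
osub-osub θ ψ (ovar k) = refl
osub-osub θ ψ (orec f) =
  cong orec (trans (osub-osub (olift θ) (olift ψ) f) (osub-ext e f))
  where
  open ≡-Reasoning
  e : ∀ k → osub (olift θ) (olift ψ k) ≡ olift (λ k → osub θ (ψ k)) k
  e zero    = refl
  e (suc k) = begin
    osub (olift θ) (osh 0 (ψ k))        ≡⟨ cong (osub (olift θ)) (osh0 (ψ k)) ⟩
    osub (olift θ) (oren suc (ψ k))     ≡⟨ osub-oren (olift θ) suc (ψ k) ⟩
    osub (λ j → osh 0 (θ j)) (ψ k)      ≡⟨ osub-ext (λ j → osh0 (θ j)) (ψ k) ⟩
    osub (λ j → oren suc (θ j)) (ψ k)   ≡⟨ sym (oren-osub suc θ (ψ k)) ⟩
    oren suc (osub θ (ψ k))             ≡⟨ sym (osh0 (osub θ (ψ k))) ⟩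
    osh 0 (osub θ (ψ k))                ∎
osubB-osubB θ ψ ⟦ p ∙ f ⟧     = cong ⟦ p ∙_⟧ (osub-osub θ ψ f)
osubB-osubB θ ψ (p ∙ f ∷ᵒ b) = cong₂ (p ∙_∷ᵒ_) (osub-osub θ ψ f) (osubB-osubB θ ψ b)

osub-id  : ∀ f → osub ovar f ≡ f
osubB-id : ∀ {P} (b : OBr P) → osubB ovar b ≡ b
osub-id o𝟏       = refl
osub-id (orL b)  = cong orL (osubB-id b)
osub-id (orR b)  = cong orR (osubB-id b)
osub-id (pre o f) = cong (pre o) (osub-id f)
osub-id (ovar k) = refl
osub-id (orec f) = cong orec (trans (osub-ext e f) (osub-id f))
  where e : ∀ k → olift ovar k ≡ ovar k
        e zero    = refl
        e (suc k) = refl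
osubB-id ⟦ p ∙ f ⟧     = cong ⟦ p ∙_⟧ (osub-id f)
osubB-id (p ∙ f ∷ᵒ b) = cong₂ (p ∙_∷ᵒ_) (osub-id f) (osubB-id b)

oren-as-osub  : ∀ r f → oren r f ≡ osub (λ k → ovar (r k)) f
orenB-as-osubB : ∀ {P} r (b : OBr P) → orenB r b ≡ osubB (λ k → ovar (r k)) b
oren-as-osub r o𝟏       = refl
oren-as-osub r (orL b)  = cong orL (orenB-as-osubB r b)
oren-as-osub r (orR b)  = cong orR (orenB-as-osubB r b)
oren-as-osub r (pre o f) = cong (pre o) (oren-as-osub r f)
oren-as-osub r (ovar k) = refl
oren-as-osub r (orec f) = cong orec (trans (oren-as-osub (liftRen r) f) (osub-ext e f))
  where e : ∀ k → ovar (liftRen r k) ≡ olift (λ k → ovar (r k)) k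
        e zero    = refl
        e (suc k) = refl
orenB-as-osubB r ⟦ p ∙ f ⟧     = cong ⟦ p ∙_⟧ (oren-as-osub r f)
orenB-as-osubB r (p ∙ f ∷ᵒ b) = cong₂ (p ∙_∷ᵒ_) (oren-as-osub r f) (orenB-as-osubB r b)

_∷ₒ_ : Orch → (ℕ → Orch) → ℕ → Orch
(x ∷ₒ θ) zero    = x
(x ∷ₒ θ) (suc k) = θ k

ounfold-def : ∀ f → ounfold f ≡ osub (orec f ∷ₒ ovar) f
ounfold-def f = osub-ext (λ { zero → refl ; (suc k) → refl }) f

unfold-osub : ∀ θ f → ounfold (osub (olift θ) f) ≡ osub (osub θ (orec f) ∷ₒ θ) f
unfold-osub θ f = begin
    ounfold (osub (olift θ) f)                          ≡⟨ ounfold-def (osub (olift θ) f) ⟩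
    osub (orec f' ∷ₒ ovar) (osub (olift θ) f)           ≡⟨ osub-osub _ (olift θ) f ⟩
    osub (λ k → osub (orec f' ∷ₒ ovar) (olift θ k)) f   ≡⟨ osub-ext e f ⟩
    osub (osub θ (orec f) ∷ₒ θ) f                       ∎
  where
  open ≡-Reasoning
  f' = osub (olift θ) f
  e : ∀ k → osub (orec f' ∷ₒ ovar) (olift θ k) ≡ (osub θ (orec f) ∷ₒ θ) k
  e zero    = refl
  e (suc k) = trans (cong (osub _) (osh0 (θ k))) (trans (osub-oren _ suc (θ k)) (osub-id (θ k)))

osub-unfold : ∀ θ f → osub θ (ounfold f) ≡ osub (osub θ (orec f) ∷ₒ θ) f
osub-unfold θ f = trans (cong (osub θ) (ounfold-def f))
  (trans (osub-osub θ (orec f ∷ₒ ovar) f) (osub-ext (λ { zero → refl ; (suc k) → refl }) f))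

≡⇒≈ᵒ : ∀ {f g} → f ≡ g → f ≈ᵒ g
≡⇒≈ᵒ refl = ≈ᵒrefl

-- ≈ᵒ is stable under substitution; in particular rule Conv is preserved by θ
osub-≈ᵒ  : ∀ θ {f g} → f ≈ᵒ g → osub θ f ≈ᵒ osub θ g
osubB-≈ᵒ : ∀ {P} θ {b c : OBr P} → b ≈ᵒB c → osubB θ b ≈ᵒB osubB θ c
osub-≈ᵒ θ ≈ᵒrefl           = ≈ᵒrefl
osub-≈ᵒ θ (≈ᵒsym d)        = ≈ᵒsym (osub-≈ᵒ θ d)
osub-≈ᵒ θ (≈ᵒtrans d d')   = ≈ᵒtrans (osub-≈ᵒ θ d) (osub-≈ᵒ θ d')
osub-≈ᵒ θ (≈ᵒunfold {f})   = ≈ᵒtrans ≈ᵒunfold (≡⇒≈ᵒ (trans (unfold-osub θ f) (sym (osub-unfold θ f))))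
osub-≈ᵒ θ (≈ᵒL d)          = ≈ᵒL (osubB-≈ᵒ θ d)
osub-≈ᵒ θ (≈ᵒR d)          = ≈ᵒR (osubB-≈ᵒ θ d)
osub-≈ᵒ θ (≈ᵒpre d)        = ≈ᵒpre (osub-≈ᵒ θ d)
osub-≈ᵒ θ (≈ᵒrec d)        = ≈ᵒrec (osub-≈ᵒ (olift θ) d)
osubB-≈ᵒ θ ≈ᵒBrefl         = ≈ᵒBrefl
osubB-≈ᵒ θ (≈ᵒBsym d)      = ≈ᵒBsym (osubB-≈ᵒ θ d)
osubB-≈ᵒ θ (≈ᵒBtrans d d') = ≈ᵒBtrans (osubB-≈ᵒ θ d) (osubB-≈ᵒ θ d')
osubB-≈ᵒ θ (≈ᵒBone d)      = ≈ᵒBone (osub-≈ᵒ θ d)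
osubB-≈ᵒ θ (≈ᵒBcons d d')  = ≈ᵒBcons (osub-≈ᵒ θ d) (osubB-≈ᵒ θ d')
osubB-≈ᵒ θ ≈ᵒBswap2        = ≈ᵒBswap2
osubB-≈ᵒ θ ≈ᵒBswap         = ≈ᵒBswap

osub-pointwise  : ∀ {θ θ'} → (∀ k → θ k ≈ᵒ θ' k) → ∀ f → osub θ f ≈ᵒ osub θ' f
osubB-pointwise : ∀ {P θ θ'} → (∀ k → θ k ≈ᵒ θ' k) → ∀ (b : OBr P) → osubB θ b ≈ᵒB osubB θ' b
osub-pointwise e o𝟏       = ≈ᵒrefl
osub-pointwise e (orL b)  = ≈ᵒL (osubB-pointwise e b)
osub-pointwise e (orR b)  = ≈ᵒR (osubB-pointwise e b)
osub-pointwise e (pre o f) = ≈ᵒpre (osub-pointwise e f)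
osub-pointwise e (ovar k) = e k
osub-pointwise {θ} {θ'} e (orec f) = ≈ᵒrec (osub-pointwise e' f)
  where
  shift-≈ᵒ : ∀ {x y} → x ≈ᵒ y → osh 0 x ≈ᵒ osh 0 y
  shift-≈ᵒ {x} {y} d = ≈ᵒtrans (≡⇒≈ᵒ (trans (osh0 x) (oren-as-osub suc x)))
    (≈ᵒtrans (osub-≈ᵒ _ d) (≡⇒≈ᵒ (sym (trans (osh0 y) (oren-as-osub suc y)))))
  e' : ∀ k → olift θ k ≈ᵒ olift θ' k
  e' zero    = ≈ᵒrefl
  e' (suc k) = shift-≈ᵒ (e k)
osubB-pointwise e ⟦ p ∙ f ⟧     = ≈ᵒBone (osub-pointwise e f)
osubB-pointwise e (p ∙ f ∷ᵒ b) = ≈ᵒBcons (osub-pointwise e f) (osubB-pointwise e b)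

oHead : Orch → Head
oHead (ovar k) = headVar k
oHead (orec f) = underRec (oHead f)
oHead _        = guarded

oBindHead : (ℕ → Orch) → Head → Head
oBindHead θ (headVar k) = oHead (θ k)
oBindHead θ h           = h

oHead-oren : ∀ r f → oHead (oren r f) ≡ renameHead r (oHead f)
oHead-oren r o𝟏       = refl
oHead-oren r (orL _)  = refl
oHead-oren r (orR _)  = refl
oHead-oren r (pre _ _) = refl
oHead-oren r (ovar _) = refl
oHead-oren r (orec f) = trans (cong underRec (oHead-oren (liftRen r) f)) (underRec-liftRen r (oHead f))

oHead-osub : ∀ θ f → oHead (osub θ f) ≡ oBindHead θ (oHead f)
oHead-osub θ o𝟏       = refl
oHead-osub θ (orL _)  = refl
oHead-osub θ (orR _)  = refl
oHead-osub θ (pre _ _) = refl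
oHead-osub θ (ovar _) = refl
oHead-osub θ (orec f) = trans (cong underRec (oHead-osub (olift θ) f)) (lifted (oHead f))
  where
  lifted : ∀ h → underRec (oBindHead (olift θ) h) ≡ oBindHead θ (underRec h)
  lifted guarded           = refl
  lifted (headVar zero)    = refl
  lifted (headVar (suc k)) =
    trans (cong underRec (trans (cong oHead (osh0 (θ k))) (oHead-oren suc (θ k))))
          (underRec-suc (oHead (θ k)))
  lifted loop              = refl

oHead-unfold : ∀ f → oHead (ounfold f) ≡ underRec (oHead f)
oHead-unfold f = trans (cong oHead (ounfold-def f))
                       (trans (oHead-osub (orec f ∷ₒ ovar) f) (unfolded (oHead f) refl))
  where
  unfolded : ∀ h → oHead f ≡ h → oBindHead (orec f ∷ₒ ovar) h ≡ underRec h
  unfolded guarded           _ = refl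
  unfolded (headVar zero)    e = cong underRec e
  unfolded (headVar (suc k)) _ = refl
  unfolded loop              _ = refl

oHead-≈ᵒ : ∀ {f g} → f ≈ᵒ g → oHead f ≡ oHead g
oHead-≈ᵒ ≈ᵒrefl         = refl
oHead-≈ᵒ (≈ᵒsym d)      = sym (oHead-≈ᵒ d)
oHead-≈ᵒ (≈ᵒtrans d d') = trans (oHead-≈ᵒ d) (oHead-≈ᵒ d')
oHead-≈ᵒ (≈ᵒunfold {f}) = sym (oHead-unfold f)
oHead-≈ᵒ (≈ᵒL _)        = refl
oHead-≈ᵒ (≈ᵒR _)        = refl
oHead-≈ᵒ (≈ᵒpre _)      = refl
oHead-≈ᵒ (≈ᵒrec d)      = cong underRec (oHead-≈ᵒ d)

oHead-loop : ∀ θ {f} → oHead f ≡ headVar zero → oHead (osub θ (orec f)) ≡ loop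
oHead-loop θ {f} e = trans (oHead-osub θ (orec f)) (cong (λ h → oBindHead θ (underRec h)) e)

oLoop-inert : ∀ {x μ y} → oHead x ≡ loop → ¬ OStep x μ y
oLoop-inert {orec f} e (recS d) = oLoop-inert (trans (oHead-unfold f) e) d

module O = UpTo OStep _≈ᵒ_ ≈ᵒrefl ≈ᵒtrans

OBranchSim : ∀ {P} → OBr P → OBr P → Set
OBranchSim b c = ∀ {p x} → (p , x) ∈OB b → ∃[ y ] ((p , y) ∈OB c × x ≈ᵒ y)

≈ᵒB⇒OBranchSim : ∀ {P} {b c : OBr P} → b ≈ᵒB c → OBranchSim b c × OBranchSim c b
≈ᵒB⇒OBranchSim ≈ᵒBrefl = (λ m → _ , m , ≈ᵒrefl) , (λ m → _ , m , ≈ᵒrefl)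
≈ᵒB⇒OBranchSim (≈ᵒBsym d) = let (p , q) = ≈ᵒB⇒OBranchSim d in q , p
≈ᵒB⇒OBranchSim (≈ᵒBtrans d d') =
  let (p , q) = ≈ᵒB⇒OBranchSim d ; (p' , q') = ≈ᵒB⇒OBranchSim d' in
  (λ m → let (_ , m' , e) = p m ; (z , m'' , e') = p' m' in z , m'' , ≈ᵒtrans e e') ,
  (λ m → let (_ , m' , e) = q' m ; (z , m'' , e') = q m' in z , m'' , ≈ᵒtrans e e')
≈ᵒB⇒OBranchSim (≈ᵒBone e) = (λ { here1 → _ , here1 , e }) , (λ { here1 → _ , here1 , ≈ᵒsym e })
≈ᵒB⇒OBranchSim (≈ᵒBcons e d) = let (p , q) = ≈ᵒB⇒OBranchSim d in
  (λ { here → _ , here , e ; (there m) → let (y , m' , e') = p m in y , there m' , e' }) ,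
  (λ { here → _ , here , ≈ᵒsym e ; (there m) → let (y , m' , e') = q m in y , there m' , e' })
≈ᵒB⇒OBranchSim ≈ᵒBswap2 =
  (λ { here → _ , there here1 , ≈ᵒrefl ; (there here1) → _ , here , ≈ᵒrefl }) ,
  (λ { here → _ , there here1 , ≈ᵒrefl ; (there here1) → _ , here , ≈ᵒrefl })
≈ᵒB⇒OBranchSim ≈ᵒBswap =
  (λ { here → _ , there here , ≈ᵒrefl ; (there here) → _ , here , ≈ᵒrefl
     ; (there (there m)) → _ , there (there m) , ≈ᵒrefl }) ,
  (λ { here → _ , there here , ≈ᵒrefl ; (there here) → _ , here , ≈ᵒrefl
     ; (there (there m)) → _ , there (there m) , ≈ᵒrefl })

OSim-L : ∀ {b c} → b ≈ᵒB c → O.Sim (orL b) (orL c)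
OSim-L d = let (p , q) = ≈ᵒB⇒OBranchSim d in match p , match q
  where
  match : ∀ {b c} → OBranchSim b c → O.Sim1 (orL b) (orL c)
  match p (orLS m) = let (y , m' , e) = p m in y , orLS m' , e

OSim-R : ∀ {b c} → b ≈ᵒB c → O.Sim (orR b) (orR c)
OSim-R d = let (p , q) = ≈ᵒB⇒OBranchSim d in match p , match q
  where
  match : ∀ {b c} → OBranchSim b c → O.Sim1 (orR b) (orR c)
  match p (orRS m) = let (y , m' , e) = p m in y , orRS m' , e

OSim-pre : ∀ {o f g} → f ≈ᵒ g → O.Sim (pre o f) (pre o g)
OSim-pre e = (λ { preS → _ , preS , e }) , (λ { preS → _ , preS , ≈ᵒsym e })

osub-rec-step : ∀ θ f {μ g} → OStep (osub θ (orec f)) μ g → OStep (osub (osub θ (orec f) ∷ₒ θ) f) μ g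
osub-rec-step θ f (recS d) = subst (λ z → OStep z _ _) (unfold-osub θ f) d

osub-rec-step⁻ : ∀ θ f {μ g} → OStep (osub (osub θ (orec f) ∷ₒ θ) f) μ g → OStep (osub θ (orec f)) μ g
osub-rec-step⁻ θ f d = recS (subst (λ z → OStep z _ _) (sym (unfold-osub θ f)) d)

OSim-osub-rec : ∀ θ θ' f f' → O.Sim (osub (osub θ (orec f) ∷ₒ θ) f) (osub (osub θ' (orec f') ∷ₒ θ') f') →
                O.Sim (osub θ (orec f)) (osub θ' (orec f'))
OSim-osub-rec θ θ' f f' (p , q) =
  (λ d → let (y , d' , e) = p (osub-rec-step θ f d) in y , osub-rec-step⁻ θ' f' d' , e) ,
  (λ d → let (y , d' , e) = q (osub-rec-step θ' f' d) in y , osub-rec-step⁻ θ f d' , e)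

OSim-osub-pointwise : ∀ f θ θ' → (∀ k → θ k ≈ᵒ θ' k) →
  (∀ k → oHead f ≡ headVar k → O.Sim (θ k) (θ' k)) → O.Sim (osub θ f) (osub θ' f)
OSim-osub-pointwise o𝟏       θ θ' pw hd = (λ ()) , (λ ())
OSim-osub-pointwise (orL b)  θ θ' pw hd = OSim-L (osubB-pointwise pw b)
OSim-osub-pointwise (orR b)  θ θ' pw hd = OSim-R (osubB-pointwise pw b)
OSim-osub-pointwise (pre o f) θ θ' pw hd = OSim-pre (osub-pointwise pw f)
OSim-osub-pointwise (ovar k) θ θ' pw hd = hd k refl
OSim-osub-pointwise (orec f) θ θ' pw hd with headZero? (oHead f)
... | inj₁ e  = O.Sim-inert (oLoop-inert (oHead-loop θ {f} e)) (oLoop-inert (oHead-loop θ' {f} e))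
... | inj₂ ne = OSim-osub-rec θ θ' f f (OSim-osub-pointwise f _ _ pw' hd')
  where
  pw' : ∀ k → (osub θ (orec f) ∷ₒ θ) k ≈ᵒ (osub θ' (orec f) ∷ₒ θ') k
  pw' zero    = osub-pointwise pw (orec f)
  pw' (suc k) = pw k
  hd' : ∀ k → oHead f ≡ headVar k → O.Sim ((osub θ (orec f) ∷ₒ θ) k) ((osub θ' (orec f) ∷ₒ θ') k)
  hd' zero    e = ⊥-elim (ne e)
  hd' (suc k) e = hd k (cong underRec e)

≈ᵒ-Sim-osub : ∀ {f g} → f ≈ᵒ g → ∀ θ → O.Sim (osub θ f) (osub θ g)
≈ᵒ-Sim-osub ≈ᵒrefl θ         = O.Sim-refl
≈ᵒ-Sim-osub (≈ᵒsym d) θ      = O.Sim-sym (≈ᵒ-Sim-osub d θ)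
≈ᵒ-Sim-osub (≈ᵒtrans d d') θ = O.Sim-trans (≈ᵒ-Sim-osub d θ) (≈ᵒ-Sim-osub d' θ)
≈ᵒ-Sim-osub (≈ᵒunfold {f}) θ =
  O.Sim-trans ((λ d → _ , osub-rec-step θ f d , ≈ᵒrefl) , (λ d → _ , osub-rec-step⁻ θ f d , ≈ᵒrefl))
              (O.Sim-≡ (sym (osub-unfold θ f)))
≈ᵒ-Sim-osub (≈ᵒL d) θ        = OSim-L (osubB-≈ᵒ θ d)
≈ᵒ-Sim-osub (≈ᵒR d) θ        = OSim-R (osubB-≈ᵒ θ d)
≈ᵒ-Sim-osub (≈ᵒpre d) θ      = OSim-pre (osub-≈ᵒ θ d)
≈ᵒ-Sim-osub (≈ᵒrec {f} {g} d) θ with headZero? (oHead g)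
... | inj₁ e  = O.Sim-inert (oLoop-inert (oHead-loop θ {f} (trans (oHead-≈ᵒ d) e)))
                            (oLoop-inert (oHead-loop θ {g} e))
... | inj₂ ne = OSim-osub-rec θ θ f g
  (O.Sim-trans (≈ᵒ-Sim-osub d (osub θ (orec f) ∷ₒ θ)) (OSim-osub-pointwise g _ _ pw hd))
  where
  pw : ∀ k → (osub θ (orec f) ∷ₒ θ) k ≈ᵒ (osub θ (orec g) ∷ₒ θ) k
  pw zero    = osub-≈ᵒ θ (≈ᵒrec d)
  pw (suc k) = ≈ᵒrefl
  hd : ∀ k → oHead g ≡ headVar k → O.Sim ((osub θ (orec f) ∷ₒ θ) k) ((osub θ (orec g) ∷ₒ θ) k)
  hd zero    e = ⊥-elim (ne e)
  hd (suc k) e = O.Sim-refl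

≈ᵒ⇒Sim : ∀ {f g} → f ≈ᵒ g → O.Sim f g
≈ᵒ⇒Sim {f} {g} d = subst₂ O.Sim (osub-id f) (osub-id g) (≈ᵒ-Sim-osub d ovar)

_≈ˢ_ : Sys → Sys → Set
(ρ ∥[ f ] σ) ≈ˢ (ρ' ∥[ f' ] σ') = (ρ ≈ ρ') × (f ≈ᵒ f') × (σ ≈ σ')

≈ˢ-sym : ∀ {s s'} → s ≈ˢ s' → s' ≈ˢ s
≈ˢ-sym {_ ∥[ _ ] _} {_ ∥[ _ ] _} (a , b , c) = ≈sym a , ≈ᵒsym b , ≈sym c

τ-sim : ∀ {s s₁ s'} → s ⟶ s₁ → s ≈ˢ s' → ∃[ s₁' ] ((s' ⟶ s₁') × s₁ ≈ˢ s₁')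
τ-sim {s' = _ ∥[ _ ] _} (τC d) (a , b , c) =
  let (_ , d' , e) = proj₁ (≈⇒Sim a) d in _ , τC d' , e , b , c
τ-sim {s' = _ ∥[ _ ] _} (τS d) (a , b , c) =
  let (_ , d' , e) = proj₁ (≈⇒Sim c) d in _ , τS d' , a , b , e

action-sim : ∀ {s s₁ s' μ} → s ⟶[ μ ] s₁ → s ≈ˢ s' → ∃[ s₁' ] ((s' ⟶[ μ ] s₁') × s₁ ≈ˢ s₁')
action-sim {s' = _ ∥[ _ ] _} (syncS d₁ d₂ d₃) (a , b , c) =
  let (_ , d₁' , e₁) = proj₁ (≈⇒Sim a) d₁
      (_ , d₂' , e₂) = proj₁ (≈ᵒ⇒Sim b) d₂
      (_ , d₃' , e₃) = proj₁ (≈⇒Sim c) d₃ in _ , syncS d₁' d₂' d₃' , e₁ , e₂ , e₃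
action-sim {s' = _ ∥[ _ ] _} (leftS d₁ d₂) (a , b , c) =
  let (_ , d₁' , e₁) = proj₁ (≈⇒Sim a) d₁
      (_ , d₂' , e₂) = proj₁ (≈ᵒ⇒Sim b) d₂ in _ , leftS d₁' d₂' , e₁ , e₂ , c
action-sim {s' = _ ∥[ _ ] _} (rightS d₂ d₃) (a , b , c) =
  let (_ , d₂' , e₂) = proj₁ (≈ᵒ⇒Sim b) d₂
      (_ , d₃' , e₃) = proj₁ (≈⇒Sim c) d₃ in _ , rightS d₂' d₃' , a , e₂ , e₃

τ*-sim : ∀ {s s₁ s'} → s ⟶* s₁ → s ≈ˢ s' → ∃[ s₁' ] ((s' ⟶* s₁') × s₁ ≈ˢ s₁')
τ*-sim ε r = _ , ε , r
τ*-sim (x ◅ xs) r with τ-sim x r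
... | _ , d , r₂ with τ*-sim xs r₂
... | s₃ , ds , r₃ = s₃ , d ◅ ds , r₃

run-sim : ∀ {s s₁ s' μs} → s ⇒[ μs ] s₁ → s ≈ˢ s' → ∃[ s₁' ] ((s' ⇒[ μs ] s₁') × s₁ ≈ˢ s₁')
run-sim (wdone x) r with τ*-sim x r
... | s₂ , d , r₂ = s₂ , wdone d , r₂
run-sim (wstep x y z) r with τ*-sim x r
... | _ , d , r₂ with action-sim y r₂
... | _ , d₃ , r₃ with run-sim z r₃
... | s₄ , d₄ , r₄ = s₄ , wstep d d₃ d₄ , r₄

trace-sim : ∀ {f g μs} → OTrace f μs → f ≈ᵒ g → OTrace g μs
trace-sim tnil e         = tnil
trace-sim (tcons d tr) e = let (_ , d' , e') = proj₁ (≈ᵒ⇒Sim e) d in tcons d' (trace-sim tr e')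

stuck-sim : ∀ {s s'} → s ≈ˢ s' → Stuck s' → Stuck s
stuck-sim r (p , q) =
  (λ _ d → let (s₁' , d' , _) = τ-sim d r in p s₁' d') ,
  (λ μ _ d → let (s₁' , d' , _) = run-sim d r in q μ s₁' d')

StrictUpTo : ℕ → Orch → SC → SC → Set
StrictUpTo n f ρ σ = ∀ μs → length μs ≤ n → OTrace f μs → ∃[ s' ] ((ρ ∥[ f ] σ) ⇒[ μs ] s')

CompliantUpTo : ℕ → Orch → SC → SC → Set
CompliantUpTo n f ρ σ = ∀ μs → length μs ≤ n → ∀ ρ' f' σ' →
  (ρ ∥[ f ] σ) ⇒[ μs ] (ρ' ∥[ f' ] σ') → Stuck (ρ' ∥[ f' ] σ') → ρ' ≈ 𝟏

DS : ℕ → Orch → SC → SC → Set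
DS n f ρ σ = StrictUpTo n f ρ σ × CompliantUpTo n f ρ σ

DS-pred : ∀ {m f ρ σ} → DS (suc m) f ρ σ → DS m f ρ σ
DS-pred (s , c) = (λ μs le → s μs (m≤n⇒m≤1+n le)) , (λ μs le → c μs (m≤n⇒m≤1+n le))

⊣ds⇒DS : ∀ {n f ρ σ} → f ∶ ρ ⊣ds σ → DS n f ρ σ
⊣ds⇒DS (s , c) = (λ μs _ → s μs) , (λ μs _ → c μs)

DS⇒⊣ds : ∀ {f ρ σ} → (∀ n → DS n f ρ σ) → f ∶ ρ ⊣ds σ
DS⇒⊣ds ds = (λ μs → proj₁ (ds (length μs)) μs ≤-refl) ,
            (λ μs → proj₂ (ds (length μs)) μs ≤-refl)

DS-≈ : ∀ {n f ρ σ f' ρ' σ'} → DS n f ρ σ → f ≈ᵒ f' → ρ ≈ ρ' → σ ≈ σ' → DS n f' ρ' σ'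
DS-≈ (str , cmp) ef eρ eσ = str' , cmp'
  where
  str' : StrictUpTo _ _ _ _
  str' μs le tr with str μs le (trace-sim tr (≈ᵒsym ef))
  ... | _ , run with run-sim run (eρ , ef , eσ)
  ... | s₁' , run' , _ = s₁' , run'
  cmp' : CompliantUpTo _ _ _ _
  cmp' μs le ρ₁ f₁ σ₁ run st with run-sim run (≈sym eρ , ≈ᵒsym ef , ≈sym eσ)
  ... | (ρ₂ ∥[ f₂ ] σ₂) , run₂ , r =
    ≈trans (proj₁ r) (cmp μs le ρ₂ f₂ σ₂ run₂ (stuck-sim (≈ˢ-sym {ρ₁ ∥[ f₁ ] σ₁} {ρ₂ ∥[ f₂ ] σ₂} r) st))

_⟶τ*_ : SC → SC → Set
_⟶τ*_ = Star (λ a b → SStep a τ b)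

silent-split : ∀ {ρ f σ s'} → (ρ ∥[ f ] σ) ⟶* s' →
  ∃[ ρ' ] ∃[ σ' ] ((s' ≡ (ρ' ∥[ f ] σ')) × ρ ⟶τ* ρ' × σ ⟶τ* σ')
silent-split ε = _ , _ , refl , ε , ε
silent-split (τC d ◅ xs) with silent-split xs
... | ρ' , σ' , e , a , b = ρ' , σ' , e , d ◅ a , b
silent-split (τS d ◅ xs) with silent-split xs
... | ρ' , σ' , e , a , b = ρ' , σ' , e , a , d ◅ b

silent-join : ∀ {ρ ρ' f σ σ'} → ρ ⟶τ* ρ' → σ ⟶τ* σ' → (ρ ∥[ f ] σ) ⟶* (ρ' ∥[ f ] σ')
silent-join a b = gmap (λ ρ → ρ ∥[ _ ] _) τC a ◅◅ gmap (λ σ → _ ∥[ _ ] σ) τS b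

CompliantUpTo-τ* : ∀ {n f ρ σ ρ₁ σ₁} → CompliantUpTo n f ρ σ → ρ ⟶τ* ρ₁ → σ ⟶τ* σ₁ →
                   CompliantUpTo n f ρ₁ σ₁
CompliantUpTo-τ* c a b μs le ρ' f' σ' (wdone x)     = c μs le ρ' f' σ' (wdone (silent-join a b ◅◅ x))
CompliantUpTo-τ* c a b μs le ρ' f' σ' (wstep x y z) = c μs le ρ' f' σ' (wstep (silent-join a b ◅◅ x) y z)

-- DS (suc m) F ρ σ follows from three facts about the states reachable
-- silently from ρ ∥[ F ] σ: none of them is stuck; after any visible action
-- the rest of the run is compliant up to m actions; every action of F can be
-- performed (possibly after silent moves) leading to a state that is strict
-- up to m actions.

NeverStuck : Orch → SC → SC → Set
NeverStuck F ρ σ = ∀ ρ₁ σ₁ → ρ ⟶τ* ρ₁ → σ ⟶τ* σ₁ → ¬ Stuck (ρ₁ ∥[ F ] σ₁)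

CompliantAfterAction : ℕ → Orch → SC → SC → Set
CompliantAfterAction m F ρ σ = ∀ ρ₁ σ₁ μ ρ₂ g σ₂ → ρ ⟶τ* ρ₁ → σ ⟶τ* σ₁ →
  (ρ₁ ∥[ F ] σ₁) ⟶[ μ ] (ρ₂ ∥[ g ] σ₂) → CompliantUpTo m g ρ₂ σ₂

StrictAfterAction : ℕ → Orch → SC → SC → Set
StrictAfterAction m F ρ σ = ∀ μ g → OStep F μ g → ∃[ ρ₁ ] ∃[ σ₁ ] ∃[ ρ₂ ] ∃[ σ₂ ]
  (ρ ⟶τ* ρ₁ × σ ⟶τ* σ₁ × ((ρ₁ ∥[ F ] σ₁) ⟶[ μ ] (ρ₂ ∥[ g ] σ₂)) × StrictUpTo m g ρ₂ σ₂)

silent-run-compliant : ∀ {F ρ σ} → NeverStuck F ρ σ → ∀ ρ' f' σ' →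
  (ρ ∥[ F ] σ) ⇒[ [] ] (ρ' ∥[ f' ] σ') → Stuck (ρ' ∥[ f' ] σ') → ρ' ≈ 𝟏
silent-run-compliant ns ρ' f' σ' (wdone x) st with silent-split x
... | ρ₁ , σ₁ , refl , a , b = ⊥-elim (ns ρ₁ σ₁ a b st)

DS-zero : ∀ {F ρ σ} → NeverStuck F ρ σ → DS 0 F ρ σ
DS-zero ns = (λ { [] _ _ → _ , wdone ε }) ,
             (λ { [] _ ρ' f' σ' run st → silent-run-compliant ns ρ' f' σ' run st })

DS-suc : ∀ {m F ρ σ} → NeverStuck F ρ σ → CompliantAfterAction m F ρ σ →
         StrictAfterAction m F ρ σ → DS (suc m) F ρ σ
DS-suc {m} {F} {ρ} {σ} ns cc cs = str , cmp
  where
  str : StrictUpTo (suc m) F ρ σ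
  str [] _ _ = _ , wdone ε
  str (μ ∷ μs) (s≤s le) (tcons d tr) with cs μ _ d
  ... | _ , _ , _ , _ , a , b , st , strict with strict μs le tr
  ... | s' , run = s' , wstep (silent-join a b) st run
  cmp : CompliantUpTo (suc m) F ρ σ
  cmp [] _ ρ' f' σ' run st = silent-run-compliant ns ρ' f' σ' run st
  cmp (μ ∷ μs) (s≤s le) ρ' f' σ' (wstep {s₂ = ρ₂ ∥[ g ] σ₂} x y z) st with silent-split x
  ... | ρ₁ , σ₁ , refl , a , b = cc ρ₁ σ₁ μ ρ₂ g σ₂ a b y μs le ρ' f' σ' z st

∈B-unique : ∀ {b a t t'} → Unique (names b) → (a , t) ∈B b → (a , t') ∈B b → t ≡ t'
∈B-unique u here1 here1 = refl
∈B-unique u here  here  = refl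
∈B-unique (fresh AllPairs.∷ u) here (there m') = ⊥-elim (notAmong fresh m' refl)
  where notAmong : ∀ {P : Name → Set} {b a t} → All P (names b) → (a , t) ∈B b → P a
        notAmong (px All.∷ _)  here1     = px
        notAmong (px All.∷ _)  here      = px
        notAmong (_ All.∷ pxs) (there m) = notAmong pxs m
∈B-unique u@(_ AllPairs.∷ _) (there m) here = sym (∈B-unique u here (there m))
∈B-unique (_ AllPairs.∷ u) (there m) (there m') = ∈B-unique u m m'

ext-unique : ∀ {b} → SessionContract (ext b) → Unique (names b)
ext-unique (wfext u _) = u

int-unique : ∀ {b} → SessionContract (int b) → Unique (names b)
int-unique (wfint u _) = u

ext-input : ∀ {b y a x} → ext b ⟶τ* y → SStep y (act (nm a)) x → (a , x) ∈B b
ext-input ε (extI m) = m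

IntDerivative : SBr → SC → Set
IntDerivative b y = (y ≡ int b) ⊎ (∃[ a ] ∃[ t ] ((a , t) ∈B b × (y ≡ int [ a ∙ t ])))

int-τ* : ∀ {b y} → int b ⟶τ* y → IntDerivative b y
int-τ* = go (inj₁ refl)
  where
  step : ∀ {b y y'} → IntDerivative b y → SStep y τ y' → IntDerivative b y'
  step (inj₁ refl)                (intτ m)    = inj₂ (_ , _ , m , refl)
  step (inj₂ (a , t , m , refl)) (intτ here1) = inj₂ (a , t , m , refl)
  go : ∀ {b x y} → IntDerivative b x → x ⟶τ* y → IntDerivative b y
  go i ε        = i
  go i (d ◅ ds) = go (step i d) ds

int-output : ∀ {b y a x} → int b ⟶τ* y → SStep y (act (co a)) x → (a , x) ∈B b
int-output r d with int-τ* r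
int-output r intO | inj₁ refl               = here1
int-output r intO | inj₂ (_ , _ , m , refl) = m

int-τ-enabled : ∀ {b y} → int b ⟶τ* y → ∃[ y' ] SStep y τ y'
int-τ-enabled {[ _ ∙ _ ]}   r with int-τ* r
... | inj₁ refl               = _ , intτ here1
... | inj₂ (_ , _ , _ , refl) = _ , intτ here1
int-τ-enabled {_ ∙ _ ∷ _} r with int-τ* r
... | inj₁ refl               = _ , intτ here
... | inj₂ (_ , _ , _ , refl) = _ , intτ here1

NeverStuck-int-client : ∀ {b F σ} → NeverStuck F (int b) σ
NeverStuck-int-client _ _ a _ (noτ , _) = let (_ , d) = int-τ-enabled a in noτ _ (τC d)

NeverStuck-int-server : ∀ {b F ρ} → NeverStuck F ρ (int b)
NeverStuck-int-server _ _ _ b (noτ , _) = let (_ , d) = int-τ-enabled b in noτ _ (τS d)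

-- When the orchestrator performs an action that involves a choice of the
-- client or server, the party involved ends in the branch for the action's
-- name, and the other party is unchanged unless it also takes part.  So
-- compliance of that continuation yields compliance of the result.

orch-step : ∀ {ρ f σ μ ρ' f' σ'} → (ρ ∥[ f ] σ) ⟶[ μ ] (ρ' ∥[ f' ] σ') → OStep f μ f'
orch-step (syncS _ d _) = d
orch-step (leftS _ d)   = d
orch-step (rightS d _)  = d

module _ {m : ℕ} {g : Orch} {a : Name} {ρ₁ σ₁ ρ₂ σ₂ : SC} {F : Orch} where

  after-input-client : ∀ {b t σ} → Unique (names b) → (a , t) ∈B b → CompliantUpTo m g t σ →
    int b ⟶τ* ρ₁ → σ ⟶τ* σ₁ → (ρ₁ ∥[ F ] σ₁) ⟶[ L (nm a) ] (ρ₂ ∥[ g ] σ₂) → CompliantUpTo m g ρ₂ σ₂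
  after-input-client u mb c r s (leftS d _) rewrite ∈B-unique u mb (int-output r d) =
    CompliantUpTo-τ* c ε s

  after-input-server : ∀ {b t ρ} → Unique (names b) → (a , t) ∈B b → CompliantUpTo m g ρ t →
    ρ ⟶τ* ρ₁ → int b ⟶τ* σ₁ → (ρ₁ ∥[ F ] σ₁) ⟶[ R (nm a) ] (ρ₂ ∥[ g ] σ₂) → CompliantUpTo m g ρ₂ σ₂
  after-input-server u mb c r s (rightS _ d) rewrite ∈B-unique u mb (int-output s d) =
    CompliantUpTo-τ* c r ε

  after-output-client : ∀ {b t σ} → Unique (names b) → (a , t) ∈B b → CompliantUpTo m g t σ →
    ext b ⟶τ* ρ₁ → σ ⟶τ* σ₁ → (ρ₁ ∥[ F ] σ₁) ⟶[ L (co a) ] (ρ₂ ∥[ g ] σ₂) → CompliantUpTo m g ρ₂ σ₂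
  after-output-client u mb c r s (leftS d _) rewrite ∈B-unique u mb (ext-input r d) =
    CompliantUpTo-τ* c ε s

  after-output-server : ∀ {b t ρ} → Unique (names b) → (a , t) ∈B b → CompliantUpTo m g ρ t →
    ρ ⟶τ* ρ₁ → ext b ⟶τ* σ₁ → (ρ₁ ∥[ F ] σ₁) ⟶[ R (co a) ] (ρ₂ ∥[ g ] σ₂) → CompliantUpTo m g ρ₂ σ₂
  after-output-server u mb c r s (rightS _ d) rewrite ∈B-unique u mb (ext-input s d) =
    CompliantUpTo-τ* c r ε

  after-sync-client-output : ∀ {bρ bσ t t'} → Unique (names bρ) → Unique (names bσ) →
    (a , t) ∈B bρ → (a , t') ∈B bσ → CompliantUpTo m g t t' →
    int bρ ⟶τ* ρ₁ → ext bσ ⟶τ* σ₁ → (ρ₁ ∥[ F ] σ₁) ⟶[ S (co a) ] (ρ₂ ∥[ g ] σ₂) → CompliantUpTo m g ρ₂ σ₂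
  after-sync-client-output uρ uσ mρ mσ c r s (syncS d _ d')
    rewrite ∈B-unique uρ mρ (int-output r d) | ∈B-unique uσ mσ (ext-input s d') = c

  after-sync-server-output : ∀ {bρ bσ t t'} → Unique (names bρ) → Unique (names bσ) →
    (a , t) ∈B bρ → (a , t') ∈B bσ → CompliantUpTo m g t t' →
    ext bρ ⟶τ* ρ₁ → int bσ ⟶τ* σ₁ → (ρ₁ ∥[ F ] σ₁) ⟶[ S (nm a) ] (ρ₂ ∥[ g ] σ₂) → CompliantUpTo m g ρ₂ σ₂
  after-sync-server-output uρ uσ mρ mσ c r s (syncS d _ d')
    rewrite ∈B-unique uρ mρ (ext-input r d) | ∈B-unique uσ mσ (int-output s d') = c

-- Every rule concludes with θ(rec x.h) where h is a prefix or a choice.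
-- Its actions are those of h, continuing as θ'(f) for the branch f taken,
-- where θ' maps x to θ(rec x.h) and the other variables as θ does.

bodySub : (ℕ → Orch) → Orch → ℕ → Orch
bodySub θ h = osub θ (orec h) ∷ₒ θ

osubB-∈ : ∀ {P} ψ {ob : OBr P} {p g} → (p , g) ∈OB osubB ψ ob → ∃[ f ] ((p , f) ∈OB ob × g ≡ osub ψ f)
osubB-∈ ψ {⟦ _ ∙ f ⟧}     here1     = f , here1 , refl
osubB-∈ ψ {_ ∙ f ∷ᵒ _}   here      = f , here , refl
osubB-∈ ψ {_ ∙ _ ∷ᵒ _}   (there m) = let (f , m' , e) = osubB-∈ ψ m in f , there m' , e

recL-step : ∀ θ {ob μ g} → OStep (osub θ (orec (orL ob))) μ g →
  ∃[ p ] ∃[ f ] ((p , f) ∈OB ob × μ ≡ ⌊ p ⌋L × g ≡ osub (bodySub θ (orL ob)) f)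
recL-step θ {ob} d with osub-rec-step θ (orL ob) d
... | orLS m = let (f , m' , e) = osubB-∈ _ m in _ , f , m' , refl , e

recR-step : ∀ θ {ob μ g} → OStep (osub θ (orec (orR ob))) μ g →
  ∃[ p ] ∃[ f ] ((p , f) ∈OB ob × μ ≡ ⌊ p ⌋R × g ≡ osub (bodySub θ (orR ob)) f)
recR-step θ {ob} d with osub-rec-step θ (orR ob) d
... | orRS m = let (f , m' , e) = osubB-∈ _ m in _ , f , m' , refl , e

recPre-step : ∀ θ {o h μ g} → OStep (osub θ (orec (pre o h))) μ g →
  μ ≡ ⌊ o ⌋O × g ≡ osub (bodySub θ (pre o h)) h
recPre-step θ {o} {h} d with osub-rec-step θ (pre o h) d
... | preS = refl , refl

recPre-step⁻ : ∀ θ {o h} → OStep (osub θ (orec (pre o h))) ⌊ o ⌋O (osub (bodySub θ (pre o h)) h)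
recPre-step⁻ θ {o} {h} = osub-rec-step⁻ θ (pre o h) preS

BrRel-branch : ∀ {P : Set} {R : Name → SC → Orch → Set} {mk : Name → P} {b ob p f} →
  BrRel R mk b ob → (p , f) ∈OB ob → ∃[ a ] ∃[ t ] ((p ≡ mk a) × (a , t) ∈B b × R a t f)
BrRel-branch (brone r)     here1     = _ , _ , refl , here1 , r
BrRel-branch (brcons r _)  here      = _ , _ , refl , here , r
BrRel-branch (brcons _ br) (there m) =
  let (a , t , e , m' , r) = BrRel-branch br m in a , t , e , there m' , r

toOBr-∈ : ∀ {P : Set} {p : P × Orch} {ps q f} → (q , f) ∈OB toOBr p ps → (q , f) ∈ (p ∷ ps)
toOBr-∈ {ps = []}    here1     = hereₗ refl
toOBr-∈ {ps = _ ∷ _} here      = hereₗ refl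
toOBr-∈ {ps = _ ∷ _} (there m) = thereₗ (toOBr-∈ m)

-- In rules OSum/SumO a branch belongs to H (the orchestrator serves it
-- alone, label mkH a) or to K (synchronisation, label mkK a).
HKBranch : {P : Set} (RH : SC → Orch → Set) (RK : SC → SC → Orch → Set) (mkH mkK : Name → P)
           (eb b : SBr) (q : P) (f : Orch) → Set
HKBranch RH RK mkH mkK eb b q f = ∃[ a ] ∃[ t ] ((a , t) ∈B b ×
  (((q ≡ mkH a) × RH t f) ⊎ ((q ≡ mkK a) × ∃[ t' ] ((a , t') ∈B eb × RK t t' f))))

HK1-branch : ∀ {P : Set} {RH RK} {mkH mkK : Name → P} {eb b a t ps q f} → (a , t) ∈B b →
  HK1 RH RK mkH mkK eb a t ps → (q , f) ∈ ps → HKBranch RH RK mkH mkK eb b q f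
HK1-branch mb (onlyH r)    (hereₗ refl)          = _ , _ , mb , inj₁ (refl , r)
HK1-branch mb (onlyK m r)  (hereₗ refl)          = _ , _ , mb , inj₂ (refl , _ , m , r)
HK1-branch mb (both r _ _) (hereₗ refl)          = _ , _ , mb , inj₁ (refl , r)
HK1-branch mb (both _ m r) (thereₗ (hereₗ refl)) = _ , _ , mb , inj₂ (refl , _ , m , r)

HK-branch : ∀ {P : Set} {RH RK} {mkH mkK : Name → P} {eb b L q f} →
  HK RH RK mkH mkK eb b L → (q , f) ∈ L → HKBranch RH RK mkH mkK eb b q f
HK-branch (hkone h) m = HK1-branch here1 h m
HK-branch (hkcons {ps = ps} h hs) m with ∈-++⁻ ps m
... | inj₁ m' = HK1-branch here h m'
... | inj₂ m' = let (a , t , mb , r) = HK-branch hs m' in a , t , there mb , r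

-- Each rule is sound for one more step: if the premises hold up to m
-- actions for the continuations θ'(f) (θ' = bodySub θ h), the conclusion
-- θ(rec x.h) satisfies DS (suc m).  Absence of stuck states comes from an
-- internal choice on one side (OOA, OOB, OSum, SumO) or from the
-- orchestrator's output to an external choice (SumL, SumR).

NeverStuck-SumL : ∀ θ {b σ a ρp f} → (a , ρp) ∈B b → NeverStuck (osub θ (orec (pre (outL a) f))) (ext b) σ
NeverStuck-SumL θ {a = a} {f = f} mb _ _ ε _ (_ , noAction) =
  noAction (L (co a)) _ (wstep ε (leftS (extI mb) (recPre-step⁻ θ {outL a} {f})) (wdone ε))

NeverStuck-SumR : ∀ θ {ρ b a σp f} → (a , σp) ∈B b → NeverStuck (osub θ (orec (pre (outR a) f))) ρ (ext b)
NeverStuck-SumR θ {a = a} {f = f} mb _ _ _ ε (_ , noAction) =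
  noAction (R (co a)) _ (wstep ε (rightS (recPre-step⁻ θ {outR a} {f}) (extI mb)) (wdone ε))

module RuleSemantics (m : ℕ) (θ : ℕ → Orch) where

  semSumL : ∀ {b σ a ρp f} → Unique (names b) → (a , ρp) ∈B b →
    DS m (osub (bodySub θ (pre (outL a) f)) f) ρp σ →
    DS (suc m) (osub θ (orec (pre (outL a) f))) (ext b) σ
  semSumL {b} {σ} {a} {ρp} {f} u mb ds = DS-suc (NeverStuck-SumL θ {f = f} mb) cc cs
    where
    cc : CompliantAfterAction m (osub θ (orec (pre (outL a) f))) (ext b) σ
    cc _ _ _ _ _ _ r s st with recPre-step θ {outL a} {f} (orch-step st)
    ... | refl , refl = after-output-client u mb (proj₂ ds) r s st
    cs : StrictAfterAction m (osub θ (orec (pre (outL a) f))) (ext b) σ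
    cs _ _ d with recPre-step θ {outL a} {f} d
    ... | refl , refl = _ , _ , _ , _ , ε , ε , leftS (extI mb) d , proj₁ ds

  semSumR : ∀ {ρ b a σp f} → Unique (names b) → (a , σp) ∈B b →
    DS m (osub (bodySub θ (pre (outR a) f)) f) ρ σp →
    DS (suc m) (osub θ (orec (pre (outR a) f))) ρ (ext b)
  semSumR {ρ} {b} {a} {σp} {f} u mb ds = DS-suc (NeverStuck-SumR θ {f = f} mb) cc cs
    where
    cc : CompliantAfterAction m (osub θ (orec (pre (outR a) f))) ρ (ext b)
    cc _ _ _ _ _ _ r s st with recPre-step θ {outR a} {f} (orch-step st)
    ... | refl , refl = after-output-server u mb (proj₂ ds) r s st
    cs : StrictAfterAction m (osub θ (orec (pre (outR a) f))) ρ (ext b)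
    cs _ _ d with recPre-step θ {outR a} {f} d
    ... | refl , refl = _ , _ , _ , _ , ε , ε , rightS d (extI mb) , proj₁ ds

  semOOA : ∀ {bρ bσ ob} → Unique (names bσ) →
    BrRel (λ _ σj fj → DS m (osub (bodySub θ (orR ob)) fj) (int bρ) σj) inR bσ ob →
    DS (suc m) (osub θ (orec (orR ob))) (int bρ) (int bσ)
  semOOA {bρ} {bσ} {ob} u br = DS-suc NeverStuck-int-client cc cs
    where
    cc : CompliantAfterAction m (osub θ (orec (orR ob))) (int bρ) (int bσ)
    cc _ _ _ _ _ _ r s st with recR-step θ (orch-step st)
    ... | _ , _ , mo , refl , refl with BrRel-branch br mo
    ... | _ , _ , refl , mb , ds = after-input-server u mb (proj₂ ds) r s st
    cs : StrictAfterAction m (osub θ (orec (orR ob))) (int bρ) (int bσ)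
    cs _ _ d with recR-step θ d
    ... | _ , _ , mo , refl , refl with BrRel-branch br mo
    ... | _ , _ , refl , mb , ds = _ , _ , _ , _ , ε , intτ mb ◅ ε , rightS d intO , proj₁ ds

  semOOB : ∀ {bρ bσ ob} → Unique (names bρ) →
    BrRel (λ _ ρi fi → DS m (osub (bodySub θ (orL ob)) fi) ρi (int bσ)) inL bρ ob →
    DS (suc m) (osub θ (orec (orL ob))) (int bρ) (int bσ)
  semOOB {bρ} {bσ} {ob} u br = DS-suc NeverStuck-int-client cc cs
    where
    cc : CompliantAfterAction m (osub θ (orec (orL ob))) (int bρ) (int bσ)
    cc _ _ _ _ _ _ r s st with recL-step θ (orch-step st)
    ... | _ , _ , mo , refl , refl with BrRel-branch br mo
    ... | _ , _ , refl , mb , ds = after-input-client u mb (proj₂ ds) r s st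
    cs : StrictAfterAction m (osub θ (orec (orL ob))) (int bρ) (int bσ)
    cs _ _ d with recL-step θ d
    ... | _ , _ , mo , refl , refl with BrRel-branch br mo
    ... | _ , _ , refl , mb , ds = _ , _ , _ , _ , intτ mb ◅ ε , ε , leftS intO d , proj₁ ds

  semOSum : ∀ {bρ bσ p ps} → Unique (names bρ) → Unique (names bσ) →
    HK (λ ρi fi → DS m (osub (bodySub θ (orL (toOBr p ps))) fi) ρi (ext bσ))
       (λ ρi σi fi → DS m (osub (bodySub θ (orL (toOBr p ps))) fi) ρi σi)
       inL synL bσ bρ (p ∷ ps) →
    DS (suc m) (osub θ (orec (orL (toOBr p ps)))) (int bρ) (ext bσ)
  semOSum {bρ} {bσ} {p} {ps} uρ uσ hk = DS-suc NeverStuck-int-client cc cs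
    where
    cc : CompliantAfterAction m (osub θ (orec (orL (toOBr p ps)))) (int bρ) (ext bσ)
    cc _ _ _ _ _ _ r s st with recL-step θ (orch-step st)
    ... | _ , _ , mo , refl , refl with HK-branch hk (toOBr-∈ mo)
    ... | _ , _ , mρ , inj₁ (refl , ds)          = after-input-client uρ mρ (proj₂ ds) r s st
    ... | _ , _ , mρ , inj₂ (refl , _ , mσ , ds) =
      after-sync-client-output uρ uσ mρ mσ (proj₂ ds) r s st
    cs : StrictAfterAction m (osub θ (orec (orL (toOBr p ps)))) (int bρ) (ext bσ)
    cs _ _ d with recL-step θ d
    ... | _ , _ , mo , refl , refl with HK-branch hk (toOBr-∈ mo)
    ... | _ , _ , mρ , inj₁ (refl , ds)          =
      _ , _ , _ , _ , intτ mρ ◅ ε , ε , leftS intO d , proj₁ ds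
    ... | _ , _ , mρ , inj₂ (refl , _ , mσ , ds) =
      _ , _ , _ , _ , intτ mρ ◅ ε , ε , syncS intO d (extI mσ) , proj₁ ds

  semSumO : ∀ {bρ bσ p ps} → Unique (names bρ) → Unique (names bσ) →
    HK (λ σj fj → DS m (osub (bodySub θ (orR (toOBr p ps))) fj) (ext bρ) σj)
       (λ σj ρj fj → DS m (osub (bodySub θ (orR (toOBr p ps))) fj) ρj σj)
       inR synR bρ bσ (p ∷ ps) →
    DS (suc m) (osub θ (orec (orR (toOBr p ps)))) (ext bρ) (int bσ)
  semSumO {bρ} {bσ} {p} {ps} uρ uσ hk = DS-suc NeverStuck-int-server cc cs
    where
    cc : CompliantAfterAction m (osub θ (orec (orR (toOBr p ps)))) (ext bρ) (int bσ)
    cc _ _ _ _ _ _ r s st with recR-step θ (orch-step st)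
    ... | _ , _ , mo , refl , refl with HK-branch hk (toOBr-∈ mo)
    ... | _ , _ , mσ , inj₁ (refl , ds)          = after-input-server uσ mσ (proj₂ ds) r s st
    ... | _ , _ , mσ , inj₂ (refl , _ , mρ , ds) =
      after-sync-server-output uρ uσ mρ mσ (proj₂ ds) r s st
    cs : StrictAfterAction m (osub θ (orec (orR (toOBr p ps)))) (ext bρ) (int bσ)
    cs _ _ d with recR-step θ d
    ... | _ , _ , mo , refl , refl with HK-branch hk (toOBr-∈ mo)
    ... | _ , _ , mσ , inj₁ (refl , ds)          =
      _ , _ , _ , _ , ε , intτ mσ ◅ ε , rightS d intO , proj₁ ds
    ... | _ , _ , mσ , inj₂ (refl , _ , mρ , ds) =
      _ , _ , _ , _ , ε , intτ mσ ◅ ε , syncS (extI mρ) d intO , proj₁ ds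

open RuleSemantics

-- Ax: 𝟏 has no moves and o𝟏 no actions, so every reachable state has client 𝟏
DS-Ax : ∀ {n σ} → DS n o𝟏 𝟏 σ
DS-Ax = str , cmp
  where
  str : StrictUpTo _ o𝟏 𝟏 _
  str []      _ _            = _ , wdone ε
  str (_ ∷ _) _ (tcons () _)
  cmp : CompliantUpTo _ o𝟏 𝟏 _
  cmp [] _ _ _ _ (wdone x) _ with silent-split x
  ... | _ , _ , refl , ε , _ = ≈refl
  cmp (_ ∷ _) _ _ _ _ (wstep x st _) _ with silent-split x
  ... | _ , _ , refl , _ , _ with orch-step st
  ... | ()

Env : ℕ → Ctx → (ℕ → Orch) → Set
Env n Γ θ = ∀ i ρ σ → Γ ∋ i ∶ ρ ≍ σ → DS n (θ i) ρ σ

Env-pred : ∀ {m Γ θ} → Env (suc m) Γ θ → Env m Γ θ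
Env-pred env i ρ σ x = DS-pred (env i ρ σ x)

-- the environment for the premises of a rule concluding θ(rec x.h):
-- the new assumption on x is only needed one action later
bodyEnv : ∀ {m Γ θ ρ σ} h → DS m (osub θ (orec h)) ρ σ → Env (suc m) Γ θ →
          Env m ((ρ , σ) ∷ Γ) (bodySub θ h)
bodyEnv h ds env zero    _ _ here      = ds
bodyEnv h ds env (suc i) ρ σ (there x) = DS-pred (env i ρ σ x)

fundamental : ∀ n {Γ f ρ σ} → Γ ⊢ f ∶ ρ ≍ σ → ∀ θ → Env n Γ θ → DS n (osub θ f) ρ σ

fundamental-branches : ∀ m {Γ} {P : Set} {mk : Name → P} (Lf Rf : SC → SC) ψ → Env m Γ ψ → ∀ {b ob} →
  BrRel (λ _ t f → Γ ⊢ f ∶ Lf t ≍ Rf t) mk b ob →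
  BrRel (λ _ t f → DS m (osub ψ f) (Lf t) (Rf t)) mk b ob
fundamental-branches m Lf Rf ψ env (brone D)     = brone (fundamental m D ψ env)
fundamental-branches m Lf Rf ψ env (brcons D br) =
  brcons (fundamental m D ψ env) (fundamental-branches m Lf Rf ψ env br)

fundamental-HK1 : ∀ m {Γ} {P : Set} {mkH mkK : Name → P} (LH RH : SC → SC) (LK RK : SC → SC → SC) ψ →
  Env m Γ ψ → ∀ {eb a t ps} →
  HK1 (λ t f → Γ ⊢ f ∶ LH t ≍ RH t) (λ t t' f → Γ ⊢ f ∶ LK t t' ≍ RK t t') mkH mkK eb a t ps →
  HK1 (λ t f → DS m (osub ψ f) (LH t) (RH t)) (λ t t' f → DS m (osub ψ f) (LK t t') (RK t t'))
      mkH mkK eb a t ps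
fundamental-HK1 m LH RH LK RK ψ env (onlyH D)     = onlyH (fundamental m D ψ env)
fundamental-HK1 m LH RH LK RK ψ env (onlyK x D)   = onlyK x (fundamental m D ψ env)
fundamental-HK1 m LH RH LK RK ψ env (both D x D') = both (fundamental m D ψ env) x (fundamental m D' ψ env)

fundamental-HK : ∀ m {Γ} {P : Set} {mkH mkK : Name → P} (LH RH : SC → SC) (LK RK : SC → SC → SC) ψ →
  Env m Γ ψ → ∀ {eb b ps} →
  HK (λ t f → Γ ⊢ f ∶ LH t ≍ RH t) (λ t t' f → Γ ⊢ f ∶ LK t t' ≍ RK t t') mkH mkK eb b ps →
  HK (λ t f → DS m (osub ψ f) (LH t) (RH t)) (λ t t' f → DS m (osub ψ f) (LK t t') (RK t t'))
     mkH mkK eb b ps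
fundamental-HK m LH RH LK RK ψ env (hkone h)     = hkone (fundamental-HK1 m LH RH LK RK ψ env h)
fundamental-HK m LH RH LK RK ψ env (hkcons h hs) =
  hkcons (fundamental-HK1 m LH RH LK RK ψ env h) (fundamental-HK m LH RH LK RK ψ env hs)

fundamental n (Ax _)          θ env = DS-Ax
fundamental n (Hyp _ _ x)     θ env = env _ _ _ x
fundamental n (Conv D ef eρ eσ _ _ _) θ env = DS-≈ (fundamental n D θ env) (osub-≈ᵒ θ ef) eρ eσ
fundamental zero (SumL {f = f} _ _ _ mb _) θ _ = DS-zero (NeverStuck-SumL θ {f = f} mb)
fundamental zero (SumR {f = f} _ _ _ mb _) θ _ = DS-zero (NeverStuck-SumR θ {f = f} mb)
fundamental zero (OOA _ _ _ _)  θ _ = DS-zero NeverStuck-int-client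
fundamental zero (OOB _ _ _ _)  θ _ = DS-zero NeverStuck-int-client
fundamental zero (OSum _ _ _ _) θ _ = DS-zero NeverStuck-int-client
fundamental zero (SumO _ _ _ _) θ _ = DS-zero NeverStuck-int-server
fundamental (suc m) D@(SumL {a = a} {f = f} wρ _ _ mb D') θ env =
  semSumL m θ {f = f} (ext-unique wρ) mb
    (fundamental m D' (bodySub θ (pre (outL a) f))
      (bodyEnv (pre (outL a) f) (fundamental m D θ (Env-pred env)) env))
fundamental (suc m) D@(SumR {a = a} {f = f} _ wσ _ mb D') θ env =
  semSumR m θ {f = f} (ext-unique wσ) mb
    (fundamental m D' (bodySub θ (pre (outR a) f))
      (bodyEnv (pre (outR a) f) (fundamental m D θ (Env-pred env)) env))
fundamental (suc m) D@(OOA {bρ = bρ} {ob = ob} _ wσ _ br) θ env =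
  semOOA m θ (int-unique wσ)
    (fundamental-branches m (λ _ → int bρ) (λ t → t) (bodySub θ (orR ob))
      (bodyEnv (orR ob) (fundamental m D θ (Env-pred env)) env) br)
fundamental (suc m) D@(OOB {bσ = bσ} {ob = ob} wρ _ _ br) θ env =
  semOOB m θ (int-unique wρ)
    (fundamental-branches m (λ t → t) (λ _ → int bσ) (bodySub θ (orL ob))
      (bodyEnv (orL ob) (fundamental m D θ (Env-pred env)) env) br)
fundamental (suc m) D@(OSum {bσ = bσ} {p = p} {ps = ps} wρ wσ _ hk) θ env =
  semOSum m θ (int-unique wρ) (ext-unique wσ)
    (fundamental-HK m (λ t → t) (λ _ → ext bσ) (λ t _ → t) (λ _ t' → t') (bodySub θ (orL (toOBr p ps)))
      (bodyEnv (orL (toOBr p ps)) (fundamental m D θ (Env-pred env)) env) hk)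
fundamental (suc m) D@(SumO {bρ = bρ} {p = p} {ps = ps} wρ wσ _ hk) θ env =
  semSumO m θ (ext-unique wρ) (int-unique wσ)
    (fundamental-HK m (λ _ → ext bρ) (λ t → t) (λ _ t' → t') (λ t _ → t) (bodySub θ (orR (toOBr p ps)))
      (bodyEnv (orR (toOBr p ps)) (fundamental m D θ (Env-pred env)) env) hk)

mainTheorem1 : ∀ (Γ : Ctx) (f : Orch) (ρ σ : SC) →
    ValidCtx Γ → SessionContract ρ → SessionContract σ →
    Γ ⊢ f ∶ ρ ≍ σ → Γ ⊨ f ∶ ρ ≍ σ
mainTheorem1 Γ f ρ σ _ _ _ D θ _ valid =
  DS⇒⊣ds (λ n → fundamental n D θ (λ i ρ' σ' x → ⊣ds⇒DS (valid i ρ' σ' x)))
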